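{- For each positive integer $k$, the number of continuous functions in $\widetilde{\mathcal{P}}_k$ is the Catalan number $C_k=\frac{1}{k+1}\binom{2k}{k}$.
   Context: The class $\mathcal{P}$ consists of all functions $f:[0,1]\to[0,1]$ such that: $f$ is weakly decreasing; $f$ is piecewise linear with finitely many non-differentiable points; all non-differentiable points of $f$ are rational numbers in $[0,1]$; there is $\varepsilon>0$ with $f(x)=1$ for all $0\le x<\varepsilon$; $f(1)>0$; and for every $a\in(0,1)$, $\lim_{x\searrow a} f(x) > 1-a$. For a positive integer $k$, $\widetilde{\mathcal{P}}_k$ is the set of $f\in\mathcal{P}$ such that: $k f(i/k)\in\mathbb{Z}$ for each $i\in\{1,\ldots,k\}$; $f$ is upper-semicontinuous; and for each $i\in\{1,\ldots,k\}$ the restriction of $f$ to $((i-1)/k,i/k)$ is linear with a non-positive integer slope.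
   Formalization: The functions are maps from the rational points of [0,1] to the rationals rather than real functions on [0,1], with continuity, upper semicontinuity, monotonicity and right limits required only at rational points. -}

module Defs where

open import Data.Nat as ℕ using (ℕ; suc; _∸_)
open import Data.Nat.Combinatorics using (_C_)
open import Data.Nat.DivMod using (_/_)
open import Data.Integer as ℤ using (ℤ; +_)
open import Data.Rational as ℚ using (ℚ; 0ℚ; 1ℚ; _≤_; _<_; _+_; _-_; _*_; ∣_∣)
open import Data.Fin using (Fin)
open import Data.List using (List)
open import Data.List.Membership.Propositional using (_∈_)
open import Data.Product using (Σ; ∃; _×_)
open import Relation.Binary.PropositionalEquality using (_≡_)
open import Relation.Nullary using (¬_)

catalan : ℕ → ℕ
catalan k = ((2 ℕ.* k) C k) / suc k

frac : ℕ → (k : ℕ) → .{{ℕ.NonZero k}} → ℚ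
frac i k = (+ i) ℚ./ k

ℤtoℚ : ℤ → ℚ
ℤtoℚ z = z ℚ./ 1

ℕtoℚ : ℕ → ℚ
ℕtoℚ n = (+ n) ℚ./ 1

-- Functions are modelled as ℚ → ℚ; only their values on I = [0,1] ∩ ℚ matter.
InI : ℚ → Set
InI x = 0ℚ ≤ x × x ≤ 1ℚ

WeaklyDecreasing : (ℚ → ℚ) → Set
WeaklyDecreasing f = ∀ x y → InI x → InI y → x ≤ y → f y ≤ f x

ValuesInI : (ℚ → ℚ) → Set
ValuesInI f = ∀ x → InI x → InI (f x)

-- piecewise linear: there is a finite list of (rational) break points such that
-- f is affine on every interval [x,z] ⊆ [0,1] containing no break point.
PiecewiseLinear : (ℚ → ℚ) → Set
PiecewiseLinear f = Σ (List ℚ) λ bs →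
  ∀ x y z → InI x → InI z → x < y → y < z →
    (∀ b → b ∈ bs → ¬ (x ≤ b × b ≤ z)) →
    (f y - f x) * (z - x) ≡ (f z - f x) * (y - x)

RightLimit : (ℚ → ℚ) → ℚ → ℚ → Set
RightLimit f a L = ∀ ε → 0ℚ < ε → Σ ℚ λ δ → 0ℚ < δ × (∀ x → InI x → a < x → x < a + δ → ∣ f x - L ∣ < ε)

InP : (ℚ → ℚ) → Set
InP f = ValuesInI f × WeaklyDecreasing f × PiecewiseLinear f
      × (Σ ℚ λ ε → 0ℚ < ε × (∀ x → 0ℚ ≤ x → x < ε → f x ≡ 1ℚ))
      × 0ℚ < f 1ℚ
      × (∀ a → 0ℚ < a → a < 1ℚ → Σ ℚ λ L → RightLimit f a L × 1ℚ - a < L)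

UpperSemicontinuous : (ℚ → ℚ) → Set
UpperSemicontinuous f = ∀ a → InI a → ∀ ε → 0ℚ < ε → Σ ℚ λ δ → 0ℚ < δ ×
  (∀ x → InI x → ∣ x - a ∣ < δ → f x < f a + ε)

Continuous : (ℚ → ℚ) → Set
Continuous f = ∀ a → InI a → ∀ ε → 0ℚ < ε → Σ ℚ λ δ → 0ℚ < δ ×
  (∀ x → InI x → ∣ x - a ∣ < δ → ∣ f x - f a ∣ < ε)

InPtilde : (k : ℕ) → .{{ℕ.NonZero k}} → (ℚ → ℚ) → Set
InPtilde k f = InP f
  × (∀ (i : ℕ) → 1 ℕ.≤ i → i ℕ.≤ k → Σ ℤ λ z → ℕtoℚ k * f (frac i k) ≡ ℤtoℚ z)
  × UpperSemicontinuous f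
  × (∀ (i : ℕ) → 1 ℕ.≤ i → i ℕ.≤ k → Σ ℤ λ s → s ℤ.≤ + 0 × Σ ℚ λ c →
       ∀ x → frac (i ∸ 1) k < x → x < frac i k → f x ≡ ℤtoℚ s * x + c)

_≈I_ : (ℚ → ℚ) → (ℚ → ℚ) → Set
f ≈I g = ∀ x → InI x → f x ≡ g x

-- "the number of functions satisfying P is n": an enumeration of exactly n
-- functions (identified when equal on [0,1]) covering all functions with P.
HasCount : ((ℚ → ℚ) → Set) → ℕ → Set
HasCount P n = Σ (Fin n → (ℚ → ℚ)) λ g →
  (∀ j → P (g j)) × (∀ j j′ → g j ≈I g j′ → j ≡ j′) × (∀ f → P f → ∃ λ j → f ≈I g j)

-- A continuous f in P̃ₖ is pinned down by the integers dᵢ ≥ 0 with −dᵢ its slope on the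
-- i-th piece [(i−1)/k, i/k]: since f = 1 near 0, continuity forces f(i/k) = 1 − (d₁ + ⋯ + dᵢ)/k,
-- and the conditions f(1) > 0 and lim_{x↘a} f(x) > 1 − a at a = i/k say exactly that
-- d₁ + ⋯ + dᵢ < i.  Conversely every such ballot sequence is realised by the continuous
-- function x ↦ 1 − Σᵢ dᵢ · clamp(x − (i−1)/k, 0, 1/k).  The number N(m, c) of sequences of
-- length m with d₁ + ⋯ + dᵢ ≤ c + i − 1 satisfies N(m+1, c+1) = N(m, c+2) + N(m+1, c) (split on
-- whether d₁ = 0), whence N(m+1, c) = C(2m+c+2, m+1) − C(2m+c+2, m), and
-- N(k, 0) = C(2k, k) − C(2k, k−1) = C(2k, k)/(k+1).

module Submission where

open import Defs
open import Data.Nat using (ℕ; NonZero)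
open import Data.Product using (_×_)

module Enumerations where

  open import Data.Nat using (ℕ; _+_)
  open import Data.Fin using (Fin; zero; splitAt; _↑ˡ_; _↑ʳ_)
  open import Data.Fin.Properties using (splitAt-↑ˡ; splitAt-↑ʳ; +↔⊎)
  open import Data.Product using (∃; _×_; _,_)
  open import Data.Sum using (_⊎_; inj₁; inj₂; [_,_]′)
  open import Data.Empty using (⊥; ⊥-elim)
  open import Function using (_∘_; Injective)
  open import Function.Bundles using (Injection)
  open import Function.Properties.Inverse using (↔⇒↣)
  open import Level using (0ℓ)
  open import Relation.Unary using (Pred; _≐_; _∪_)
  open import Relation.Binary.PropositionalEquality

  record Enumeration {A : Set} (P : Pred A 0ℓ) (n : ℕ) : Set where
    field
      elem      : Fin n → A
      sound     : ∀ i → P (elem i)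
      injective : Injective _≡_ _≡_ elem
      complete  : ∀ {a} → P a → ∃ λ i → elem i ≡ a

  module _ {A : Set} where

    Image : (A → A) → Pred A 0ℓ → Pred A 0ℓ
    Image g P b = ∃ λ a → P a × g a ≡ b

    singleton : (a : A) → Enumeration (_≡ a) 1
    singleton a = record
      { elem      = λ _ → a
      ; sound     = λ _ → refl
      ; injective = λ { {zero} {zero} _ → refl }
      ; complete  = λ a′≡a → zero , sym a′≡a
      }

    resp-≐ : ∀ {P Q : Pred A 0ℓ} {n} → P ≐ Q → Enumeration P n → Enumeration Q n
    resp-≐ (P⊆Q , Q⊆P) E = record
      { elem = elem ; sound = P⊆Q ∘ sound ; injective = injective ; complete = complete ∘ Q⊆P }
      where open Enumeration E

    image : ∀ {P : Pred A 0ℓ} {n} {g : A → A} → Injective _≡_ _≡_ g →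
            Enumeration P n → Enumeration (Image g P) n
    image {g = g} g-inj E = record
      { elem      = g ∘ elem
      ; sound     = λ i → elem i , sound i , refl
      ; injective = injective ∘ g-inj
      ; complete  = λ { (a , Pa , refl) → let i , elem-i≡a = complete Pa in i , cong g elem-i≡a }
      }
      where open Enumeration E

    union : ∀ {P Q : Pred A 0ℓ} {m n} → (∀ {a} → P a → Q a → ⊥) →
            Enumeration P m → Enumeration Q n → Enumeration (P ∪ Q) (m + n)
    union {P} {Q} {m} {n} disjoint E F = record
      { elem      = elem⊎ ∘ splitAt m
      ; sound     = sound⊎ ∘ splitAt m
      ; injective = Injection.injective (↔⇒↣ +↔⊎) ∘ elem⊎-injective _ _
      ; complete  = complete⊎
      }
      where
      module E = Enumeration E
      module F = Enumeration F

      elem⊎ : Fin m ⊎ Fin n → A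
      elem⊎ = [ E.elem , F.elem ]′

      sound⊎ : ∀ s → (P ∪ Q) (elem⊎ s)
      sound⊎ (inj₁ i) = inj₁ (E.sound i)
      sound⊎ (inj₂ j) = inj₂ (F.sound j)

      elem⊎-injective : ∀ s t → elem⊎ s ≡ elem⊎ t → s ≡ t
      elem⊎-injective (inj₁ i) (inj₁ j) eq = cong inj₁ (E.injective eq)
      elem⊎-injective (inj₂ i) (inj₂ j) eq = cong inj₂ (F.injective eq)
      elem⊎-injective (inj₁ i) (inj₂ j) eq = ⊥-elim (disjoint (E.sound i) (subst Q (sym eq) (F.sound j)))
      elem⊎-injective (inj₂ i) (inj₁ j) eq = ⊥-elim (disjoint (E.sound j) (subst Q eq (F.sound i)))

      complete⊎ : ∀ {a} → (P ∪ Q) a → ∃ λ i → elem⊎ (splitAt m i) ≡ a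
      complete⊎ (inj₁ Pa) with i , eq ← E.complete Pa = i ↑ˡ n , trans (cong elem⊎ (splitAt-↑ˡ m i n)) eq
      complete⊎ (inj₂ Qa) with j , eq ← F.complete Qa = m ↑ʳ j , trans (cong elem⊎ (splitAt-↑ʳ m n j)) eq

module BallotSequences where

  open import Data.Nat
  open import Data.Nat.Properties
  open import Data.Nat.Combinatorics using (_C_; nC1≡n; nCk≡nC[n∸k]; nCk+nC[k+1]≡[n+1]C[k+1]; nCk≡n!/k![n-k]!; k![n∸k]!∣n!)
  open import Data.Nat.DivMod using (m/n*n≡m; m*n/n≡m)
  open import Data.Nat.Tactic.RingSolver using (solve-∀)
  open import Algebra.Properties.CommutativeSemigroup *-commutativeSemigroup using (x∙yz≈y∙xz)
  open import Algebra.Properties.CommutativeSemigroup +-commutativeSemigroup using ()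
    renaming (interchange to +-interchange)
  open import Data.List using (List; []; _∷_; length; take)
  open import Data.List.Properties using (∷-injectiveʳ)
  open import Data.Nat.ListAction using (sum)
  open import Data.Product using (_×_; _,_)
  open import Data.Sum using (inj₁; inj₂)
  open import Data.Unit using (⊤; tt)
  open import Data.Empty using (⊥)
  open import Function using (Injective)
  open import Relation.Unary using (_≐_; _∪_)
  open import Relation.Unary.Properties using (≐-sym)
  open import Relation.Binary.PropositionalEquality
  open Enumerations

  -- BallotSeq m c ds: ds = d₁ … dₘ with d₁ + ⋯ + dᵢ ≤ c + i − 1 for every i, by recursion
  -- on the slack c that is left before the next entry.
  BallotSeq : ℕ → ℕ → List ℕ → Set
  BallotSeq zero    c []       = ⊤
  BallotSeq zero    c (_ ∷ _)  = ⊥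
  BallotSeq (suc m) c []       = ⊥
  BallotSeq (suc m) c (d ∷ ds) = d ≤ c × BallotSeq m (suc c ∸ d) ds

  ballots : ℕ → ℕ → ℕ
  ballots zero    c       = 1
  ballots (suc m) zero    = ballots m 1
  ballots (suc m) (suc c) = ballots m (suc (suc c)) + ballots (suc m) c

  incrHead : List ℕ → List ℕ
  incrHead []       = []
  incrHead (d ∷ ds) = suc d ∷ ds

  incrHead-injective : Injective _≡_ _≡_ incrHead
  incrHead-injective {[]}     {[]}     _    = refl
  incrHead-injective {_ ∷ _}  {_ ∷ _}  refl = refl

  BallotSeq-zero : ∀ {c} → BallotSeq zero c ≐ (_≡ [])
  BallotSeq-zero = (λ { {[]} _ → refl }) , λ { refl → tt }

  BallotSeq-suc-zero : ∀ {m} → BallotSeq (suc m) zero ≐ Image (0 ∷_) (BallotSeq m 1)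
  BallotSeq-suc-zero =
    (λ { {0 ∷ ds} (_ , b) → ds , b , refl }) , λ { (ds , b , refl) → z≤n , b }

  BallotSeq-suc-suc : ∀ {m c} → BallotSeq (suc m) (suc c) ≐
                      Image (0 ∷_) (BallotSeq m (suc (suc c))) ∪ Image incrHead (BallotSeq (suc m) c)
  BallotSeq-suc-suc = split , join
    where
    split : ∀ {m c ds} → BallotSeq (suc m) (suc c) ds →
            (Image (0 ∷_) (BallotSeq m (suc (suc c))) ∪ Image incrHead (BallotSeq (suc m) c)) ds
    split {ds = 0 ∷ ds}     (_ , b)       = inj₁ (ds , b , refl)
    split {ds = suc d ∷ ds} (s≤s d≤c , b) = inj₂ (d ∷ ds , (d≤c , b) , refl)
    join : ∀ {m c ds} → (Image (0 ∷_) (BallotSeq m (suc (suc c))) ∪ Image incrHead (BallotSeq (suc m) c)) ds →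
           BallotSeq (suc m) (suc c) ds
    join (inj₁ (ds , b , refl))            = z≤n , b
    join (inj₂ (d ∷ ds , (d≤c , b) , refl)) = s≤s d≤c , b

  enumerateBallots : ∀ m c → Enumeration (BallotSeq m c) (ballots m c)
  enumerateBallots zero    c       = resp-≐ (≐-sym BallotSeq-zero) (singleton [])
  enumerateBallots (suc m) zero    =
    resp-≐ (≐-sym BallotSeq-suc-zero) (image ∷-injectiveʳ (enumerateBallots m 1))
  enumerateBallots (suc m) (suc c) = resp-≐ (≐-sym BallotSeq-suc-suc)
    (union head-0≢suc (image ∷-injectiveʳ (enumerateBallots m (suc (suc c))))
                      (image incrHead-injective (enumerateBallots (suc m) c)))
    where
    head-0≢suc : ∀ {ds} → Image (0 ∷_) (BallotSeq m (suc (suc c))) ds →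
                 Image incrHead (BallotSeq (suc m) c) ds → ⊥
    head-0≢suc (_ , _ , refl) (_ ∷ _ , _ , ())

  PrefixBound : ℕ → List ℕ → Set
  PrefixBound c ds = ∀ i → i < length ds → sum (take (suc i) ds) ≤ c + i

  private
    slack-budget : ∀ {d c} i → d ≤ c → d + (suc c ∸ d + i) ≡ c + suc i
    slack-budget {d} {c} i d≤c = begin
      d + (suc c ∸ d + i)    ≡⟨ cong (λ x → d + (x + i)) (+-∸-assoc 1 d≤c) ⟩
      d + suc (c ∸ d + i)    ≡⟨ +-suc d (c ∸ d + i) ⟩
      suc (d + (c ∸ d + i))  ≡⟨ cong suc (+-assoc d (c ∸ d) i) ⟨
      suc (d + (c ∸ d) + i)  ≡⟨ cong (λ x → suc (x + i)) (m+[n∸m]≡n d≤c) ⟩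
      suc (c + i)            ≡⟨ +-suc c i ⟨
      c + suc i              ∎
      where open ≡-Reasoning

  BallotSeq⇒length : ∀ m c ds → BallotSeq m c ds → length ds ≡ m
  BallotSeq⇒length zero    c []       _       = refl
  BallotSeq⇒length (suc m) c (d ∷ ds) (_ , b) = cong suc (BallotSeq⇒length m (suc c ∸ d) ds b)

  BallotSeq⇒PrefixBound : ∀ m c ds → BallotSeq m c ds → PrefixBound c ds
  BallotSeq⇒PrefixBound (suc m) c (d ∷ ds) (d≤c , b) zero    _         = +-monoˡ-≤ 0 d≤c
  BallotSeq⇒PrefixBound (suc m) c (d ∷ ds) (d≤c , b) (suc i) (s≤s i<n) = begin
    d + sum (take (suc i) ds) ≤⟨ +-monoʳ-≤ d (BallotSeq⇒PrefixBound m (suc c ∸ d) ds b i i<n) ⟩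
    d + (suc c ∸ d + i)       ≡⟨ slack-budget i d≤c ⟩
    c + suc i                 ∎
    where open ≤-Reasoning

  PrefixBound⇒BallotSeq : ∀ m c ds → length ds ≡ m → PrefixBound c ds → BallotSeq m c ds
  PrefixBound⇒BallotSeq zero    c []       _   _     = tt
  PrefixBound⇒BallotSeq (suc m) c (d ∷ ds) len bound =
    d≤c , PrefixBound⇒BallotSeq m (suc c ∸ d) ds (suc-injective len) tail-bound
    where
    d≤c : d ≤ c
    d≤c = subst₂ _≤_ (+-identityʳ d) (+-identityʳ c) (bound 0 (s≤s z≤n))
    tail-bound : PrefixBound (suc c ∸ d) ds
    tail-bound i i<n = +-cancelˡ-≤ d _ _
      (subst (d + sum (take (suc i) ds) ≤_) (sym (slack-budget i d≤c)) (bound (suc i) (s≤s i<n)))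

  take-sums-injective : ∀ ds es → length ds ≡ length es →
                        (∀ i → i ≤ length ds → sum (take i ds) ≡ sum (take i es)) → ds ≡ es
  take-sums-injective []       []       _   _    = refl
  take-sums-injective (d ∷ ds) (e ∷ es) len sums =
    cong₂ _∷_ d≡e (take-sums-injective ds es (suc-injective len) tail-sums)
    where
    d≡e : d ≡ e
    d≡e = +-cancelʳ-≡ 0 d e (sums 1 (s≤s z≤n))
    tail-sums : ∀ i → i ≤ length ds → sum (take i ds) ≡ sum (take i es)
    tail-sums i i≤n = +-cancelˡ-≡ d _ _ (trans (sums (suc i) (s≤s i≤n)) (cong (_+ sum (take i es)) (sym d≡e)))

  C*k!*[n∸k]!≡n! : ∀ {n k} → k ≤ n → (n C k) * (k ! * (n ∸ k) !) ≡ n !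
  C*k!*[n∸k]!≡n! {n} {k} k≤n = begin
    (n C k) * (k ! * (n ∸ k) !)                 ≡⟨ cong (_* (k ! * (n ∸ k) !)) (nCk≡n!/k![n-k]! k≤n) ⟩
    n ! / (k ! * (n ∸ k) !) * (k ! * (n ∸ k) !) ≡⟨ m/n*n≡m (k![n∸k]!∣n! k≤n) ⟩
    n !                                         ∎
    where
    open ≡-Reasoning
    instance _ = k !* (n ∸ k) !≢0

  absorption : ∀ a b → ((a + suc b) C suc a) * suc a ≡ ((a + suc b) C a) * suc b
  absorption a b = *-cancelʳ-≡ _ _ (a ! * b !) {{a !* b !≢0}} (begin
    (n C suc a) * suc a * (a ! * b !)   ≡⟨ *-assoc (n C suc a) (suc a) (a ! * b !) ⟩
    (n C suc a) * (suc a * (a ! * b !)) ≡⟨ cong ((n C suc a) *_) (*-assoc (suc a) (a !) (b !)) ⟨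
    (n C suc a) * (suc a ! * b !)       ≡⟨ cong (λ x → (n C suc a) * (suc a ! * x !)) n∸[1+a]≡b ⟨
    (n C suc a) * (suc a ! * (n ∸ suc a) !) ≡⟨ C*k!*[n∸k]!≡n! (subst (suc a ≤_) (sym (+-suc a b)) (s≤s (m≤m+n a b))) ⟩
    n !                                 ≡⟨ C*k!*[n∸k]!≡n! (m≤m+n a (suc b)) ⟨
    (n C a) * (a ! * (n ∸ a) !)         ≡⟨ cong (λ x → (n C a) * (a ! * x !)) (m+n∸m≡n a (suc b)) ⟩
    (n C a) * (a ! * suc b !)           ≡⟨ cong ((n C a) *_) (x∙yz≈y∙xz (a !) (suc b) (b !)) ⟩
    (n C a) * (suc b * (a ! * b !))     ≡⟨ *-assoc (n C a) (suc b) (a ! * b !) ⟨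
    (n C a) * suc b * (a ! * b !)       ∎)
    where
    open ≡-Reasoning
    n = a + suc b
    n∸[1+a]≡b : n ∸ suc a ≡ b
    n∸[1+a]≡b = trans (cong (_∸ suc a) (+-suc a b)) (m+n∸m≡n a b)

  ballots-one : ∀ c → ballots 1 c ≡ suc c
  ballots-one zero    = refl
  ballots-one (suc c) = cong suc (ballots-one c)

  private
    2[2+m]+0≡1+[2[1+m]+1] : ∀ m → 2 * suc (suc m) + 0 ≡ suc (2 * suc m + 1)
    2[2+m]+0≡1+[2[1+m]+1] = solve-∀

    2[1+m]+1≡[1+m]+[2+m] : ∀ m → 2 * suc m + 1 ≡ suc m + suc (suc m)
    2[1+m]+1≡[1+m]+[2+m] = solve-∀

    2[1+m]+[2+c]≡2[2+m]+c : ∀ m c → 2 * suc m + suc (suc c) ≡ 2 * suc (suc m) + c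
    2[1+m]+[2+c]≡2[2+m]+c = solve-∀

    2[1+m]≡m+[2+m] : ∀ m → 2 * suc m ≡ m + suc (suc m)
    2[1+m]≡m+[2+m] = solve-∀

  ballots-suc : ∀ m c → ballots (suc m) c + (2 * suc m + c) C m ≡ (2 * suc m + c) C suc m
  ballots-suc zero c = begin
    ballots 1 c + 1 ≡⟨ cong (_+ 1) (ballots-one c) ⟩
    suc c + 1       ≡⟨ +-comm (suc c) 1 ⟩
    2 + c           ≡⟨ nC1≡n (2 + c) ⟨
    (2 + c) C 1     ∎
    where open ≡-Reasoning
  ballots-suc (suc m) zero =
    subst (λ x → ballots (suc m) 1 + x C suc m ≡ x C suc (suc m)) (sym 2[2+m]+0≡1+n) (begin
      b + suc n C suc m               ≡⟨ cong (b +_) (pascal n m) ⟨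
      b + (n C m + n C suc m)         ≡⟨ +-assoc b (n C m) (n C suc m) ⟨
      b + n C m + n C suc m           ≡⟨ cong (_+ n C suc m) (ballots-suc m 1) ⟩
      n C suc m + n C suc m           ≡⟨ cong (n C suc m +_) middle-symmetric ⟩
      n C suc m + n C suc (suc m)     ≡⟨ pascal n (suc m) ⟩
      suc n C suc (suc m)             ∎)
    where
    open ≡-Reasoning
    pascal = nCk+nC[k+1]≡[n+1]C[k+1]
    b = ballots (suc m) 1
    n = 2 * suc m + 1
    2[2+m]+0≡1+n : 2 * suc (suc m) + 0 ≡ suc n
    2[2+m]+0≡1+n = 2[2+m]+0≡1+[2[1+m]+1] m
    n≡[1+m]+[2+m] : n ≡ suc m + suc (suc m)
    n≡[1+m]+[2+m] = 2[1+m]+1≡[1+m]+[2+m] m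
    middle-symmetric : n C suc m ≡ n C suc (suc m)
    middle-symmetric = begin
      n C suc m           ≡⟨ nCk≡nC[n∸k] (subst (suc m ≤_) (sym n≡[1+m]+[2+m]) (m≤m+n (suc m) _)) ⟩
      n C (n ∸ suc m)     ≡⟨ cong (λ x → n C (x ∸ suc m)) n≡[1+m]+[2+m] ⟩
      n C (suc m + suc (suc m) ∸ suc m) ≡⟨ cong (n C_) (m+n∸m≡n (suc m) (suc (suc m))) ⟩
      n C suc (suc m)     ∎
  ballots-suc (suc m) (suc c) =
    subst (λ x → b₂ + b₁ + x C suc m ≡ x C suc (suc m)) (sym (+-suc (2 * suc (suc m)) c)) (begin
      b₂ + b₁ + suc X C suc m           ≡⟨ cong (b₂ + b₁ +_) (pascal X m) ⟨
      b₂ + b₁ + (X C m + X C suc m)     ≡⟨ +-interchange b₂ b₁ (X C m) (X C suc m) ⟩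
      (b₂ + X C m) + (b₁ + X C suc m)   ≡⟨ cong₂ _+_ first-half (ballots-suc (suc m) c) ⟩
      X C suc m + X C suc (suc m)       ≡⟨ pascal X (suc m) ⟩
      suc X C suc (suc m)               ∎)
    where
    open ≡-Reasoning
    pascal = nCk+nC[k+1]≡[n+1]C[k+1]
    b₁ = ballots (suc (suc m)) c
    b₂ = ballots (suc m) (suc (suc c))
    X = 2 * suc (suc m) + c
    first-half : b₂ + X C m ≡ X C suc m
    first-half = subst (λ x → b₂ + x C m ≡ x C suc m) (2[1+m]+[2+c]≡2[2+m]+c m c) (ballots-suc m (suc (suc c)))

  ballots-catalan : ∀ k → ballots k 0 ≡ catalan k
  ballots-catalan zero    = refl
  ballots-catalan (suc m) = begin
    b                           ≡⟨ m*n/n≡m b (suc (suc m)) ⟨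
    b * suc (suc m) / suc (suc m) ≡⟨ cong (_/ suc (suc m)) b*[2+m]≡A ⟩
    A / suc (suc m)             ∎
    where
    open ≡-Reasoning
    b = ballots (suc m) 0
    n = 2 * suc m
    A = n C suc m
    B = n C m
    n≡m+[2+m] : n ≡ m + suc (suc m)
    n≡m+[2+m] = 2[1+m]≡m+[2+m] m
    b+B≡A : b + B ≡ A
    b+B≡A = subst (λ x → b + x C m ≡ x C suc m) (+-identityʳ n) (ballots-suc m 0)
    A*[1+m]≡B*[2+m] : A * suc m ≡ B * suc (suc m)
    A*[1+m]≡B*[2+m] = subst (λ x → (x C suc m) * suc m ≡ (x C m) * suc (suc m)) (sym n≡m+[2+m]) (absorption m (suc m))
    b*[2+m]≡A : b * suc (suc m) ≡ A
    b*[2+m]≡A = +-cancelʳ-≡ (A * suc m) _ _ (begin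
      b * suc (suc m) + A * suc m         ≡⟨ cong (b * suc (suc m) +_) A*[1+m]≡B*[2+m] ⟩
      b * suc (suc m) + B * suc (suc m)   ≡⟨ *-distribʳ-+ (suc (suc m)) b B ⟨
      (b + B) * suc (suc m)               ≡⟨ cong (_* suc (suc m)) b+B≡A ⟩
      A * suc (suc m)                     ≡⟨ *-suc A (suc m) ⟩
      A + A * suc m                       ∎)

open import Data.Nat as ℕ using (zero; suc; z≤n; s≤s)
import Data.Nat.Properties as ℕₚ
open import Data.Integer as ℤ using (ℤ; +_; -[1+_])
import Data.Integer.Properties as ℤₚ
open import Data.Rational as ℚ
  using (ℚ; mkℚ; 0ℚ; 1ℚ; _≤_; _<_; _+_; _-_; _*_; -_; ∣_∣; _⊓_; _⊔_; *≤*; *<*; positive; nonNegative; fromℚᵘ)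
open import Data.Rational.Properties
open import Data.Rational.Solver using (module +-*-Solver)
open +-*-Solver using (solve; _:+_; _:*_; _:-_; :-_; _:=_; con)
import Data.Rational.Unnormalised as ℚᵘ
import Data.Rational.Unnormalised.Properties as ℚᵘₚ
import Data.Nat.Coprimality as Coprime
open import Data.Product using (Σ; ∃; _,_; proj₁; proj₂)
open import Data.Sum using (_⊎_; inj₁; inj₂)
open import Data.List using (List; []; _∷_; length; take; applyUpTo)
open import Data.List.Membership.Propositional using (_∈_)
open import Data.List.Membership.Propositional.Properties using (∈-applyUpTo⁺)
open import Data.Nat.ListAction using (sum)
open import Data.Empty using (⊥-elim)
open import Function using (_∘_)
open import Relation.Nullary using (yes; no; ¬_)
open import Relation.Binary.Definitions using (tri<; tri≈; tri>)
open import Relation.Binary.PropositionalEquality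
open Enumerations using (Enumeration)
open BallotSequences using (PrefixBound; take-sums-injective; enumerateBallots; ballots-catalan;
                            BallotSeq⇒length; BallotSeq⇒PrefixBound; PrefixBound⇒BallotSeq)

-- Rational arithmetic

fromℚᵘ-* : ∀ p q → fromℚᵘ (p ℚᵘ.* q) ≡ fromℚᵘ p * fromℚᵘ q
fromℚᵘ-* p q = toℚᵘ-injective (ℚᵘₚ.≃-trans (toℚᵘ-fromℚᵘ (p ℚᵘ.* q)) (ℚᵘₚ.≃-sym
  (ℚᵘₚ.≃-trans (toℚᵘ-homo-* (fromℚᵘ p) (fromℚᵘ q)) (ℚᵘₚ.*-cong (toℚᵘ-fromℚᵘ p) (toℚᵘ-fromℚᵘ q)))))

-- ι, node and fromSlopes below are opaque so that they stay rigid under unification: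
-- unfolded into ℚ arithmetic they would block the inference of implicit arguments.
opaque
  ι : ℕ → ℚ
  ι = ℕtoℚ

opaque
  unfolding ι

  ι≡ℕtoℚ : ∀ n → ι n ≡ ℕtoℚ n
  ι≡ℕtoℚ n = refl

  ι-0 : ι 0 ≡ 0ℚ
  ι-0 = refl

  ι-1 : ι 1 ≡ 1ℚ
  ι-1 = refl

  ι≡mkℚ : ∀ n → ι n ≡ mkℚ (+ n) 0 (Coprime.sym (Coprime.1-coprimeTo n))
  ι≡mkℚ n = ↥p/↧p≡p (mkℚ (+ n) 0 (Coprime.sym (Coprime.1-coprimeTo n)))

  ι-+ : ∀ m n → ι (m ℕ.+ n) ≡ ι m + ι n
  ι-+ m n = trans
    (cong₂ (λ a b → (a ℤ.+ b) ℚ./ 1) (sym (ℤₚ.*-identityʳ (+ m))) (sym (ℤₚ.*-identityʳ (+ n))))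
    (cong₂ _+_ (sym (ι≡mkℚ m)) (sym (ι≡mkℚ n)))

  ι-mono-≤ : ∀ {m n} → m ℕ.≤ n → ι m ≤ ι n
  ι-mono-≤ {m} {n} m≤n = subst₂ _≤_ (sym (ι≡mkℚ m)) (sym (ι≡mkℚ n))
    (*≤* (subst₂ ℤ._≤_ (sym (ℤₚ.*-identityʳ (+ m))) (sym (ℤₚ.*-identityʳ (+ n))) (ℤ.+≤+ m≤n)))

  ι-mono-< : ∀ {m n} → m ℕ.< n → ι m < ι n
  ι-mono-< {m} {n} m<n = subst₂ _<_ (sym (ι≡mkℚ m)) (sym (ι≡mkℚ n))
    (*<* (subst₂ ℤ._<_ (sym (ℤₚ.*-identityʳ (+ m))) (sym (ℤₚ.*-identityʳ (+ n))) (ℤ.+<+ m<n)))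

  ℤtoℚ-nonPos : ∀ {s} → s ℤ.≤ + 0 → ℤtoℚ s ≡ - ι ℤ.∣ s ∣
  ℤtoℚ-nonPos {+ zero}    _            = refl
  ℤtoℚ-nonPos {+ suc n}   (ℤ.+≤+ ())
  ℤtoℚ-nonPos { -[1+ n ]} _            = refl

  ℤtoℚ-neg : ∀ n → ℤtoℚ (ℤ.- + n) ≡ - ι n
  ℤtoℚ-neg zero    = refl
  ℤtoℚ-neg (suc n) = refl

  frac≡ι*frac1 : ∀ i k .{{_ : ℕ.NonZero k}} → frac i k ≡ ι i * frac 1 k
  frac≡ι*frac1 i (suc k-1) = trans
    (fromℚᵘ-cong {ℚᵘ.mkℚᵘ (+ i) k-1} {ℚᵘ.mkℚᵘ (+ i) 0 ℚᵘ.* ℚᵘ.mkℚᵘ (+ 1) k-1} (ℚᵘ.*≡* eq))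
    (fromℚᵘ-* (ℚᵘ.mkℚᵘ (+ i) 0) (ℚᵘ.mkℚᵘ (+ 1) k-1))
    where
    eq : + i ℤ.* + suc (k-1 ℕ.+ 0) ≡ (+ i ℤ.* + 1) ℤ.* + suc k-1
    eq = cong₂ (λ a b → a ℤ.* + suc b) (sym (ℤₚ.*-identityʳ (+ i))) (ℕₚ.+-identityʳ k-1)

  ι*frac1≡1 : ∀ k .{{_ : ℕ.NonZero k}} → ι k * frac 1 k ≡ 1ℚ
  ι*frac1≡1 k@(suc k-1) = trans (sym (frac≡ι*frac1 k k))
    (fromℚᵘ-cong {ℚᵘ.mkℚᵘ (+ k) k-1} {ℚᵘ.mkℚᵘ (+ 1) 0}
      (ℚᵘ.*≡* (trans (ℤₚ.*-identityʳ (+ k)) (sym (ℤₚ.*-identityˡ (+ k))))))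

ι-cancel-< : ∀ {m n} → ι m < ι n → m ℕ.< n
ι-cancel-< ιm<ιn = ℕₚ.≰⇒> λ n≤m → <-irrefl refl (<-≤-trans ιm<ιn (ι-mono-≤ n≤m))

0≤ι : ∀ n → 0ℚ ≤ ι n
0≤ι n = subst (_≤ ι n) ι-0 (ι-mono-≤ z≤n)

ι-∸ : ∀ {m n} → m ℕ.≤ n → ι (n ℕ.∸ m) ≡ ι n - ι m
ι-∸ {m} {n} m≤n = begin
  ι (n ℕ.∸ m)                 ≡⟨ lemma (ι m) (ι (n ℕ.∸ m)) ⟩
  ι m + ι (n ℕ.∸ m) - ι m     ≡⟨ cong (_- ι m) (ι-+ m (n ℕ.∸ m)) ⟨
  ι (m ℕ.+ (n ℕ.∸ m)) - ι m   ≡⟨ cong (λ x → ι x - ι m) (ℕₚ.m+[n∸m]≡n m≤n) ⟩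
  ι n - ι m                   ∎
  where
  open ≡-Reasoning
  lemma : ∀ a b → b ≡ a + b - a
  lemma = solve 2 (λ a b → b := a :+ b :- a) refl

-ℕ≤0 : ∀ n → ℤ.- (+ n) ℤ.≤ + 0
-ℕ≤0 zero    = ℤ.+≤+ z≤n
-ℕ≤0 (suc n) = ℤ.-≤+

p≤q⇒0≤q-p : ∀ {p q} → p ≤ q → 0ℚ ≤ q - p
p≤q⇒0≤q-p {p} {q} p≤q = subst (_≤ q - p) (+-inverseʳ p) (+-monoˡ-≤ (- p) p≤q)

p<q⇒0<q-p : ∀ {p q} → p < q → 0ℚ < q - p
p<q⇒0<q-p {p} {q} p<q = subst (_< q - p) (+-inverseʳ p) (+-monoˡ-< (- p) p<q)

0<q-p⇒p<q : ∀ {p q} → 0ℚ < q - p → p < q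
0<q-p⇒p<q {p} {q} 0<q-p = subst₂ _<_ (+-identityˡ p) (lemma p q) (+-monoˡ-< p 0<q-p)
  where lemma : ∀ p q → q - p + p ≡ q
        lemma = solve 2 (λ p q → q :- p :+ p := q) refl

0<* : ∀ {p q} → 0ℚ < p → 0ℚ < q → 0ℚ < p * q
0<* {p} {q} 0<p 0<q = positive⁻¹ (p * q) {{pos*pos⇒pos p {{positive 0<p}} q {{positive 0<q}}}}

0≤* : ∀ {p q} → 0ℚ ≤ p → 0ℚ ≤ q → 0ℚ ≤ p * q
0≤* {p} {q} 0≤p 0≤q = nonNegative⁻¹ (p * q) {{nonNeg*nonNeg⇒nonNeg p {{nonNegative 0≤p}} q {{nonNegative 0≤q}}}}

0<⊓ : ∀ {p q} → 0ℚ < p → 0ℚ < q → 0ℚ < p ⊓ q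
0<⊓ {p} {q} 0<p 0<q with ⊓-sel p q
... | inj₁ p⊓q≡p = subst (0ℚ <_) (sym p⊓q≡p) 0<p
... | inj₂ p⊓q≡q = subst (0ℚ <_) (sym p⊓q≡q) 0<q

⅓ : ℚ
⅓ = + 1 ℚ./ 3

∃η+η< : ∀ {μ} → 0ℚ < μ → ∃ λ η → 0ℚ < η × η + η < μ
∃η+η< {μ} 0<μ = μ * ⅓ , 0<μ⅓ , 0<q-p⇒p<q (subst (0ℚ <_) (lemma μ) 0<μ⅓)
  where
  0<μ⅓ = 0<* 0<μ (positive⁻¹ ⅓)
  lemma : ∀ μ → μ * ⅓ ≡ μ - (μ * ⅓ + μ * ⅓)
  lemma = solve 1 (λ μ → μ :* (con ⅓) := μ :- (μ :* (con ⅓) :+ μ :* (con ⅓))) refl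

-- Continuous functions on [0, 1]

∣p-q∣<3ε⇒p≡q : ∀ {p q} → (∀ ε → 0ℚ < ε → ∣ p - q ∣ < ε + ε + ε) → p ≡ q
∣p-q∣<3ε⇒p≡q {p} {q} close with <-cmp 0ℚ ∣ p - q ∣
... | tri< 0<d _ _ = ⊥-elim (<-irrefl (lemma ∣ p - q ∣) (close (∣ p - q ∣ * ⅓) (0<* 0<d (positive⁻¹ ⅓))))
  where lemma : ∀ d → d ≡ d * ⅓ + d * ⅓ + d * ⅓
        lemma = solve 1 (λ d → d := d :* (con ⅓) :+ d :* (con ⅓) :+ d :* (con ⅓)) refl
... | tri≈ _ 0≡d _ = trans (lemma p q) (trans (cong (_+ q) (∣p∣≡0⇒p≡0 (p - q) (sym 0≡d))) (+-identityˡ q))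
  where lemma : ∀ p q → p ≡ p - q + q
        lemma = solve 2 (λ p q → p := p :- q :+ q) refl
... | tri> _ _ d<0 = ⊥-elim (<-irrefl refl (<-≤-trans d<0 (0≤∣p∣ (p - q))))

∣p-q-q∣≤∣p∣+∣q∣+∣q∣ : ∀ p q → ∣ p - q - q ∣ ≤ ∣ p ∣ + ∣ q ∣ + ∣ q ∣
∣p-q-q∣≤∣p∣+∣q∣+∣q∣ p q = ≤-trans (∣p-q∣≤∣p∣+∣q∣ (p - q) q) (+-monoˡ-≤ ∣ q ∣ (∣p-q∣≤∣p∣+∣q∣ p q))

∣[a+ση]-a∣≡η : ∀ a σ η → ∣ σ ∣ ≡ 1ℚ → 0ℚ ≤ η → ∣ (a + σ * η) - a ∣ ≡ η
∣[a+ση]-a∣≡η a σ η ∣σ∣≡1 0≤η = begin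
  ∣ (a + σ * η) - a ∣  ≡⟨ cong ∣_∣ (lemma a σ η) ⟩
  ∣ σ * η ∣            ≡⟨ ∣p*q∣≡∣p∣*∣q∣ σ η ⟩
  ∣ σ ∣ * ∣ η ∣        ≡⟨ cong₂ _*_ ∣σ∣≡1 (0≤p⇒∣p∣≡p 0≤η) ⟩
  1ℚ * η               ≡⟨ *-identityˡ η ⟩
  η                    ∎
  where
  open ≡-Reasoning
  lemma : ∀ a σ η → (a + σ * η) - a ≡ σ * η
  lemma = solve 3 (λ a σ η → (a :+ σ :* η) :- a := σ :* η) refl

-- σ = ±1 selects the side from which a is approached.  Comparing f with
-- the affine map at a + ση and a + 2ση cancels the slope m, so no bound on m is needed.
affine-endpoint : ∀ {f a r σ m c} → Continuous f → InI a → 0ℚ < r → ∣ σ ∣ ≡ 1ℚ →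
  (∀ η → 0ℚ < η → η < r → InI (a + σ * η) × f (a + σ * η) ≡ m * (a + σ * η) + c) →
  f a ≡ m * a + c
affine-endpoint {f} {a} {r} {σ} {m} {c} cont Ia 0<r ∣σ∣≡1 affine = ∣p-q∣<3ε⇒p≡q close
  where
  close : ∀ ε → 0ℚ < ε → ∣ f a - (m * a + c) ∣ < ε + ε + ε
  close ε 0<ε = begin-strict
    ∣ f a - (m * a + c) ∣
      ≡⟨ cong ∣_∣ (two-point (f a) m a σ η c) ⟩
    ∣ (m * x₂ + c - f a) - (m * x₁ + c - f a) - (m * x₁ + c - f a) ∣
      ≡⟨ cong₂ (λ y₁ y₂ → ∣ (y₂ - f a) - (y₁ - f a) - (y₁ - f a) ∣) fx₁ fx₂ ⟨
    ∣ (f x₂ - f a) - (f x₁ - f a) - (f x₁ - f a) ∣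
      ≤⟨ ∣p-q-q∣≤∣p∣+∣q∣+∣q∣ (f x₂ - f a) (f x₁ - f a) ⟩
    ∣ f x₂ - f a ∣ + ∣ f x₁ - f a ∣ + ∣ f x₁ - f a ∣
      <⟨ +-mono-< (+-mono-< (near 0<2η 2η<δ⊓r) (near 0<η η<δ⊓r)) (near 0<η η<δ⊓r) ⟩
    ε + ε + ε
      ∎
    where
    open ≤-Reasoning
    δ = proj₁ (cont a Ia ε 0<ε)
    0<δ = proj₁ (proj₂ (cont a Ia ε 0<ε))
    near-a = proj₂ (proj₂ (cont a Ia ε 0<ε))
    η = proj₁ (∃η+η< (0<⊓ 0<δ 0<r))
    0<η = proj₁ (proj₂ (∃η+η< (0<⊓ 0<δ 0<r)))
    2η<δ⊓r = proj₂ (proj₂ (∃η+η< (0<⊓ 0<δ 0<r)))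
    two-point : ∀ y m a σ η c →
      y - (m * a + c) ≡ (m * (a + σ * (η + η)) + c - y) - (m * (a + σ * η) + c - y) - (m * (a + σ * η) + c - y)
    two-point = solve 6 (λ y m a σ η c → y :- (m :* a :+ c) :=
      (m :* (a :+ σ :* (η :+ η)) :+ c :- y) :- (m :* (a :+ σ :* η) :+ c :- y) :- (m :* (a :+ σ :* η) :+ c :- y)) refl
    0<2η = +-mono-< 0<η 0<η
    η<2η : η < η + η
    η<2η = subst (_< η + η) (+-identityʳ η) (+-monoʳ-< η 0<η)
    η<δ⊓r = <-trans η<2η 2η<δ⊓r
    x₁ = a + σ * η
    x₂ = a + σ * (η + η)
    on-line : ∀ {η′} → 0ℚ < η′ → η′ < δ ⊓ r → InI (a + σ * η′) × f (a + σ * η′) ≡ m * (a + σ * η′) + c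
    on-line 0<η′ η′<δ⊓r = affine _ 0<η′ (<-≤-trans η′<δ⊓r (p⊓q≤q δ r))
    near : ∀ {η′} → 0ℚ < η′ → η′ < δ ⊓ r → ∣ f (a + σ * η′) - f a ∣ < ε
    near {η′} 0<η′ η′<δ⊓r = near-a (a + σ * η′) (proj₁ (on-line 0<η′ η′<δ⊓r))
      (subst (_< δ) (sym (∣[a+ση]-a∣≡η a σ η′ ∣σ∣≡1 (<⇒≤ 0<η′))) (<-≤-trans η′<δ⊓r (p⊓q≤p δ r)))
    fx₁ = proj₂ (on-line 0<η η<δ⊓r)
    fx₂ = proj₂ (on-line 0<2η 2η<δ⊓r)

p≤∣p∣ : ∀ p → p ≤ ∣ p ∣
p≤∣p∣ p with 0ℚ ≤? p
... | yes 0≤p = ≤-reflexive (sym (0≤p⇒∣p∣≡p 0≤p))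
... | no  0≰p = ≤-trans (<⇒≤ (≰⇒> 0≰p)) (0≤∣p∣ p)

≤⇒<⊎≡ : ∀ {p q} → p ≤ q → p < q ⊎ p ≡ q
≤⇒<⊎≡ {p} {q} p≤q with <-cmp p q
... | tri< p<q _ _ = inj₁ p<q
... | tri≈ _ p≡q _ = inj₂ p≡q
... | tri> _ _ q<p = ⊥-elim (<-irrefl refl (<-≤-trans q<p p≤q))

InI-between : ∀ {p q x} → InI p → InI q → p ≤ x → x ≤ q → InI x
InI-between (0≤p , _) (_ , q≤1) p≤x x≤q = ≤-trans 0≤p p≤x , ≤-trans x≤q q≤1

module _ {f : ℚ → ℚ} {p q m c : ℚ} (cont : Continuous f) (Ip : InI p) (Iq : InI q) (p<q : p < q)
         (affine : ∀ x → p < x → x < q → f x ≡ m * x + c) where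

  private
    0<q-p = p<q⇒0<q-p p<q

    inside : ∀ {x} → 0ℚ < x - p → 0ℚ < q - x → InI x × f x ≡ m * x + c
    inside {x} 0<x-p 0<q-x = InI-between Ip Iq (<⇒≤ p<x) (<⇒≤ x<q) , affine x p<x x<q
      where
      p<x = 0<q-p⇒p<q 0<x-p
      x<q = 0<q-p⇒p<q 0<q-x

    0<[q-p]-η : ∀ {η} → η < q - p → 0ℚ < (q - p) - η
    0<[q-p]-η = p<q⇒0<q-p

  affine-left-endpoint : f p ≡ m * p + c
  affine-left-endpoint = affine-endpoint {f} {m = m} {c = c} cont Ip 0<q-p refl λ η 0<η η<q-p →
    inside (subst (0ℚ <_) (lemma₁ p η) 0<η) (subst (0ℚ <_) (lemma₂ p q η) (0<[q-p]-η η<q-p))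
    where
    lemma₁ : ∀ p η → η ≡ (p + 1ℚ * η) - p
    lemma₁ = solve 2 (λ p η → η := (p :+ (con 1ℚ) :* η) :- p) refl
    lemma₂ : ∀ p q η → (q - p) - η ≡ q - (p + 1ℚ * η)
    lemma₂ = solve 3 (λ p q η → (q :- p) :- η := q :- (p :+ (con 1ℚ) :* η)) refl

  affine-right-endpoint : f q ≡ m * q + c
  affine-right-endpoint = affine-endpoint {f} {σ = - 1ℚ} {m = m} {c = c} cont Iq 0<q-p refl λ η 0<η η<q-p →
    inside (subst (0ℚ <_) (lemma₁ p q η) (0<[q-p]-η η<q-p)) (subst (0ℚ <_) (lemma₂ q η) 0<η)
    where
    lemma₁ : ∀ p q η → (q - p) - η ≡ (q + - 1ℚ * η) - p
    lemma₁ = solve 3 (λ p q η → (q :- p) :- η := (q :+ :- (con 1ℚ) :* η) :- p) refl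
    lemma₂ : ∀ q η → η ≡ q - (q + - 1ℚ * η)
    lemma₂ = solve 2 (λ q η → η := q :- (q :+ :- (con 1ℚ) :* η)) refl

  affine-on-closure : ∀ x → p ≤ x → x ≤ q → f x ≡ m * x + c
  affine-on-closure x p≤x x≤q with ≤⇒<⊎≡ p≤x | ≤⇒<⊎≡ x≤q
  ... | inj₁ p<x  | inj₁ x<q  = affine x p<x x<q
  ... | inj₂ refl | _         = affine-left-endpoint
  ... | inj₁ _    | inj₂ refl = affine-right-endpoint

lipschitz⇒continuous : ∀ {f} n → (∀ t u → ∣ f u - f t ∣ ≤ ι n * ∣ u - t ∣) → Continuous f
lipschitz⇒continuous {f} n lipschitz a _ ε 0<ε = δ , 0<δ , λ x _ ∣x-a∣<δ → begin-strict
  ∣ f x - f a ∣     ≤⟨ lipschitz a x ⟩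
  ι n * ∣ x - a ∣   ≤⟨ *-monoˡ-≤-nonNeg (ι n) {{nonNegative (0≤ι n)}} (<⇒≤ ∣x-a∣<δ) ⟩
  ι n * δ           <⟨ *-monoˡ-<-pos δ {{positive 0<δ}} (ι-mono-< (ℕₚ.n<1+n n)) ⟩
  ι (suc n) * δ     ≡⟨ lemma (ι (suc n)) ε (frac 1 (suc n)) ⟩
  ε * (ι (suc n) * frac 1 (suc n)) ≡⟨ cong (ε *_) (ι*frac1≡1 (suc n)) ⟩
  ε * 1ℚ            ≡⟨ *-identityʳ ε ⟩
  ε                 ∎
  where
  open ≤-Reasoning
  δ = ε * frac 1 (suc n)
  0<δ = 0<* 0<ε (positive⁻¹ (frac 1 (suc n)) {{normalize-pos 1 (suc n)}})
  lemma : ∀ k ε w → k * (ε * w) ≡ ε * (k * w)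
  lemma = solve 3 (λ k ε w → k :* (ε :* w) := ε :* (k :* w)) refl

∣x-a∣<δ-from-right : ∀ {a x δ} → a < x → x < a + δ → ∣ x - a ∣ < δ
∣x-a∣<δ-from-right {a} {x} {δ} a<x x<a+δ = begin-strict
  ∣ x - a ∣   ≡⟨ 0≤p⇒∣p∣≡p (p≤q⇒0≤q-p (<⇒≤ a<x)) ⟩
  x - a       <⟨ +-monoˡ-< (- a) x<a+δ ⟩
  a + δ - a   ≡⟨ lemma a δ ⟩
  δ           ∎
  where
  open ≤-Reasoning
  lemma : ∀ a δ → a + δ - a ≡ δ
  lemma = solve 2 (λ a δ → a :+ δ :- a := δ) refl

continuous⇒rightLimit : ∀ {f a} → Continuous f → InI a → RightLimit f a (f a)
continuous⇒rightLimit {f} {a} cont Ia ε 0<ε =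
  let δ , 0<δ , near-a = cont a Ia ε 0<ε
  in δ , 0<δ , λ x Ix a<x x<a+δ → near-a x Ix (∣x-a∣<δ-from-right a<x x<a+δ)

continuous⇒upperSemicontinuous : ∀ {f} → Continuous f → UpperSemicontinuous f
continuous⇒upperSemicontinuous {f} cont a Ia ε 0<ε =
  let δ , 0<δ , near-a = cont a Ia ε 0<ε
  in δ , 0<δ , λ x Ix ∣x-a∣<δ → 0<q-p⇒p<q (subst (0ℚ <_) (lemma (f a) ε (f x))
                                   (p<q⇒0<q-p (≤-<-trans (p≤∣p∣ (f x - f a)) (near-a x Ix ∣x-a∣<δ))))
  where
  lemma : ∀ y ε z → ε - (z - y) ≡ y + ε - z
  lemma = solve 3 (λ y ε z → ε :- (z :- y) := y :+ ε :- z) refl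

continuous⇒rightLimit≡value : ∀ {f a L} → Continuous f → InI a → a < 1ℚ → RightLimit f a L → L ≡ f a
continuous⇒rightLimit≡value {f} {a} {L} cont Ia a<1 limit = ∣p-q∣<3ε⇒p≡q close
  where
  close : ∀ ε → 0ℚ < ε → ∣ L - f a ∣ < ε + ε + ε
  close ε 0<ε = begin-strict
    ∣ L - f a ∣                        ≡⟨ cong ∣_∣ (lemma L (f a) (f x)) ⟩
    ∣ (f x - f a) - (f x - L) ∣        ≤⟨ ∣p-q∣≤∣p∣+∣q∣ (f x - f a) (f x - L) ⟩
    ∣ f x - f a ∣ + ∣ f x - L ∣        <⟨ +-mono-< near-fa near-L ⟩
    ε + ε                              <⟨ subst (_< ε + ε + ε) (+-identityʳ (ε + ε)) (+-monoʳ-< (ε + ε) 0<ε) ⟩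
    ε + ε + ε                          ∎
    where
    open ≤-Reasoning
    lemma : ∀ L y z → L - y ≡ (z - y) - (z - L)
    lemma = solve 3 (λ L y z → L :- y := (z :- y) :- (z :- L)) refl
    δL = proj₁ (limit ε 0<ε)
    δC = proj₁ (cont a Ia ε 0<ε)
    μ = (δL ⊓ δC) ⊓ (1ℚ - a)
    0<μ = 0<⊓ (0<⊓ (proj₁ (proj₂ (limit ε 0<ε))) (proj₁ (proj₂ (cont a Ia ε 0<ε)))) (p<q⇒0<q-p a<1)
    η = proj₁ (<-dense 0<μ)
    0<η = proj₁ (proj₂ (<-dense 0<μ))
    η<μ = proj₂ (proj₂ (<-dense 0<μ))
    x = a + η
    a<x : a < x
    a<x = subst (_< x) (+-identityʳ a) (+-monoʳ-< a 0<η)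
    x<a+ : ∀ {r} → μ ≤ r → x < a + r
    x<a+ μ≤r = +-monoʳ-< a (<-≤-trans η<μ μ≤r)
    Ix : InI x
    Ix = ≤-trans (proj₁ Ia) (<⇒≤ a<x) ,
         <⇒≤ (subst (x <_) (lemma′ a) (x<a+ (p⊓q≤q (δL ⊓ δC) (1ℚ - a))))
      where lemma′ : ∀ a → a + (1ℚ - a) ≡ 1ℚ
            lemma′ = solve 1 (λ a → a :+ ((con 1ℚ) :- a) := (con 1ℚ)) refl
    near-L : ∣ f x - L ∣ < ε
    near-L = proj₂ (proj₂ (limit ε 0<ε)) x Ix a<x
      (x<a+ (≤-trans (p⊓q≤p (δL ⊓ δC) (1ℚ - a)) (p⊓q≤p δL δC)))
    near-fa : ∣ f x - f a ∣ < ε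
    near-fa = proj₂ (proj₂ (cont a Ia ε 0<ε)) x Ix
      (∣x-a∣<δ-from-right a<x (x<a+ (≤-trans (p⊓q≤p (δL ⊓ δC) (1ℚ - a)) (p⊓q≤q δL δC))))

collinear : ∀ {f : ℚ → ℚ} m c {x y z} → f x ≡ m * x + c → f y ≡ m * y + c → f z ≡ m * z + c →
            (f y - f x) * (z - x) ≡ (f z - f x) * (y - x)
collinear {f} m c {x} {y} {z} fx fy fz = begin
  (f y - f x) * (z - x)                          ≡⟨ cong₂ (λ u v → (v - u) * (z - x)) fx fy ⟩
  (m * y + c - (m * x + c)) * (z - x)            ≡⟨ lemma m c x y z ⟩
  (m * z + c - (m * x + c)) * (y - x)            ≡⟨ cong₂ (λ u w → (w - u) * (y - x)) fx fz ⟨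
  (f z - f x) * (y - x)                          ∎
  where
  open ≡-Reasoning
  lemma : ∀ m c x y z → (m * y + c - (m * x + c)) * (z - x) ≡ (m * z + c - (m * x + c)) * (y - x)
  lemma = solve 5 (λ m c x y z → (m :* y :+ c :- (m :* x :+ c)) :* (z :- x) := (m :* z :+ c :- (m :* x :+ c)) :* (y :- x)) refl

p≤p+q : ∀ {p q} → 0ℚ ≤ q → p ≤ p + q
p≤p+q {p} {q} 0≤q = subst (_≤ p + q) (+-identityʳ p) (+-monoʳ-≤ p 0≤q)

∣p-q∣≡∣q-p∣ : ∀ p q → ∣ p - q ∣ ≡ ∣ q - p ∣
∣p-q∣≡∣q-p∣ p q = trans (cong ∣_∣ (lemma p q)) (∣-p∣≡∣p∣ (q - p))
  where lemma : ∀ p q → p - q ≡ - (q - p)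
        lemma = solve 2 (λ p q → p :- q := :- (q :- p)) refl

-- Monotone Lipschitz maps

MonotoneLipschitz : ℚ → (ℚ → ℚ) → Set
MonotoneLipschitz L g = ∀ {t u} → t ≤ u → g t ≤ g u × g u - g t ≤ L * (u - t)

private
  p≤q+r⇒p-q≤r : ∀ {a b d} → a ≤ b + d → a - b ≤ 1ℚ * d
  p≤q+r⇒p-q≤r {a} {b} {d} a≤b+d = subst₂ _≤_ refl (lemma b d) (+-monoˡ-≤ (- b) a≤b+d)
    where lemma : ∀ b d → b + d - b ≡ 1ℚ * d
          lemma = solve 2 (λ b d → b :+ d :- b := (con 1ℚ) :* d) refl

⊔-monotoneLipschitz : ∀ c → MonotoneLipschitz 1ℚ (_⊔ c)
⊔-monotoneLipschitz c {t} {u} t≤u = ⊔-monoˡ-≤ c t≤u , p≤q+r⇒p-q≤r (⊔-lub u≤ c≤)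
  where
  u≤ : u ≤ t ⊔ c + (u - t)
  u≤ = subst (_≤ t ⊔ c + (u - t)) (lemma t u) (+-monoˡ-≤ (u - t) (p≤p⊔q t c))
    where lemma : ∀ t u → t + (u - t) ≡ u
          lemma = solve 2 (λ t u → t :+ (u :- t) := u) refl
  c≤ : c ≤ t ⊔ c + (u - t)
  c≤ = ≤-trans (p≤q⊔p t c) (p≤p+q (p≤q⇒0≤q-p t≤u))

⊓-monotoneLipschitz : ∀ c → MonotoneLipschitz 1ℚ (_⊓ c)
⊓-monotoneLipschitz c {t} {u} t≤u = ⊓-monoˡ-≤ c t≤u , p≤q+r⇒p-q≤r (bound (⊓-sel t c))
  where
  bound : t ⊓ c ≡ t ⊎ t ⊓ c ≡ c → u ⊓ c ≤ t ⊓ c + (u - t)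
  bound (inj₁ t⊓c≡t) = subst (u ⊓ c ≤_) (trans (lemma t u) (cong (_+ (u - t)) (sym t⊓c≡t))) (p⊓q≤p u c)
    where lemma : ∀ t u → u ≡ t + (u - t)
          lemma = solve 2 (λ t u → u := t :+ (u :- t)) refl
  bound (inj₂ t⊓c≡c) = subst (λ y → u ⊓ c ≤ y + (u - t)) (sym t⊓c≡c)
    (≤-trans (p⊓q≤q u c) (p≤p+q (p≤q⇒0≤q-p t≤u)))

shift-monotoneLipschitz : ∀ a → MonotoneLipschitz 1ℚ (_- a)
shift-monotoneLipschitz a {t} {u} t≤u = +-monoˡ-≤ (- a) t≤u , ≤-reflexive (lemma a t u)
  where lemma : ∀ a t u → (u - a) - (t - a) ≡ 1ℚ * (u - t)
        lemma = solve 3 (λ a t u → (u :- a) :- (t :- a) := (con 1ℚ) :* (u :- t)) refl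

∘-monotoneLipschitz : ∀ {g h} → MonotoneLipschitz 1ℚ g → MonotoneLipschitz 1ℚ h →
                      MonotoneLipschitz 1ℚ (λ x → g (h x))
∘-monotoneLipschitz {g} {h} g-ml h-ml {t} {u} t≤u =
  proj₁ (g-ml (proj₁ (h-ml t≤u))) , (begin
    g (h u) - g (h t)  ≤⟨ proj₂ (g-ml (proj₁ (h-ml t≤u))) ⟩
    1ℚ * (h u - h t)   ≡⟨ *-identityˡ (h u - h t) ⟩
    h u - h t          ≤⟨ proj₂ (h-ml t≤u) ⟩
    1ℚ * (u - t)       ∎)
  where open ≤-Reasoning

const-monotoneLipschitz : ∀ c → MonotoneLipschitz 0ℚ (λ _ → c)
const-monotoneLipschitz c {t} {u} _ = ≤-refl , ≤-reflexive (lemma c t u)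
  where lemma : ∀ c t u → c - c ≡ 0ℚ * (u - t)
        lemma = solve 3 (λ c t u → c :- c := (con 0ℚ) :* (u :- t)) refl

*-monotoneLipschitz : ∀ {a L g} → 0ℚ ≤ a → MonotoneLipschitz L g → MonotoneLipschitz (a * L) (λ x → a * g x)
*-monotoneLipschitz {a} {L} {g} 0≤a g-ml {t} {u} t≤u =
  *-monoˡ-≤-nonNeg a {{nonNegative 0≤a}} (proj₁ (g-ml t≤u)) , (begin
    a * g u - a * g t    ≡⟨ lemma₁ a (g u) (g t) ⟩
    a * (g u - g t)      ≤⟨ *-monoˡ-≤-nonNeg a {{nonNegative 0≤a}} (proj₂ (g-ml t≤u)) ⟩
    a * (L * (u - t))    ≡⟨ *-assoc a L (u - t) ⟨
    a * L * (u - t)      ∎)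
  where
  open ≤-Reasoning
  lemma₁ : ∀ a x y → a * x - a * y ≡ a * (x - y)
  lemma₁ = solve 3 (λ a x y → a :* x :- a :* y := a :* (x :- y)) refl

+-monotoneLipschitz : ∀ {L M g h} → MonotoneLipschitz L g → MonotoneLipschitz M h →
                      MonotoneLipschitz (L + M) (λ x → g x + h x)
+-monotoneLipschitz {L} {M} {g} {h} g-ml h-ml {t} {u} t≤u =
  +-mono-≤ (proj₁ (g-ml t≤u)) (proj₁ (h-ml t≤u)) , (begin
    (g u + h u) - (g t + h t)          ≡⟨ lemma₁ (g u) (h u) (g t) (h t) ⟩
    (g u - g t) + (h u - h t)          ≤⟨ +-mono-≤ (proj₂ (g-ml t≤u)) (proj₂ (h-ml t≤u)) ⟩
    L * (u - t) + M * (u - t)          ≡⟨ *-distribʳ-+ (u - t) L M ⟨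
    (L + M) * (u - t)                  ∎)
  where
  open ≤-Reasoning
  lemma₁ : ∀ a b c d → (a + b) - (c + d) ≡ (a - c) + (b - d)
  lemma₁ = solve 4 (λ a b c d → (a :+ b) :- (c :+ d) := (a :- c) :+ (b :- d)) refl

monotoneLipschitz⇒lipschitz : ∀ {L g} → MonotoneLipschitz L g → ∀ t u → ∣ g u - g t ∣ ≤ L * ∣ u - t ∣
monotoneLipschitz⇒lipschitz {L} {g} g-ml t u with ≤-total t u
... | inj₁ t≤u = subst₂ (λ x y → x ≤ L * y)
  (sym (0≤p⇒∣p∣≡p (p≤q⇒0≤q-p (proj₁ (g-ml t≤u))))) (sym (0≤p⇒∣p∣≡p (p≤q⇒0≤q-p t≤u))) (proj₂ (g-ml t≤u))
... | inj₂ u≤t = subst₂ (λ x y → x ≤ L * y)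
  (trans (sym (0≤p⇒∣p∣≡p (p≤q⇒0≤q-p (proj₁ (g-ml u≤t))))) (∣p-q∣≡∣q-p∣ (g t) (g u)))
  (trans (sym (0≤p⇒∣p∣≡p (p≤q⇒0≤q-p u≤t))) (∣p-q∣≡∣q-p∣ t u)) (proj₂ (g-ml u≤t))

nth : ℕ → List ℕ → ℕ
nth _       []       = 0
nth zero    (d ∷ _)  = d
nth (suc i) (_ ∷ ds) = nth i ds

sum-take-suc : ∀ i ds → sum (take (suc i) ds) ≡ sum (take i ds) ℕ.+ nth i ds
sum-take-suc zero    []       = refl
sum-take-suc (suc i) []       = refl
sum-take-suc zero    (d ∷ ds) = ℕₚ.+-identityʳ d
sum-take-suc (suc i) (d ∷ ds) = trans (cong (d ℕ.+_) (sum-take-suc i ds)) (sym (ℕₚ.+-assoc d _ _))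

+-cancelˡ : ∀ r {p q} → r + p ≡ r + q → p ≡ q
+-cancelˡ r {p} {q} eq = trans (lemma r p) (trans (cong (_- r) eq) (sym (lemma r q)))
  where lemma : ∀ r p → p ≡ r + p - r
        lemma = solve 2 (λ r p → p := r :+ p :- r) refl

1-p<1-q⇒q<p : ∀ {p q} → 1ℚ - p < 1ℚ - q → q < p
1-p<1-q⇒q<p {p} {q} lt = 0<q-p⇒p<q (subst (0ℚ <_) (lemma p q) (p<q⇒0<q-p lt))
  where lemma : ∀ p q → (1ℚ - q) - (1ℚ - p) ≡ p - q
        lemma = solve 2 (λ p q → ((con 1ℚ) :- q) :- ((con 1ℚ) :- p) := p :- q) refl

1-p≡1-q⇒p≡q : ∀ {p q} → 1ℚ - p ≡ 1ℚ - q → p ≡ q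
1-p≡1-q⇒p≡q {p} {q} eq = trans (lemma p) (trans (cong (λ y → 1ℚ - y) eq) (sym (lemma q)))
  where lemma : ∀ p → p ≡ 1ℚ - (1ℚ - p)
        lemma = solve 1 (λ p → p := (con 1ℚ) :- ((con 1ℚ) :- p)) refl

finite-choice : ∀ {P : ℕ → ℕ → Set} n → (∀ i → i ℕ.< n → ∃ (P i)) →
              ∃ λ ds → length ds ≡ n × (∀ i → i ℕ.< n → P i (nth i ds))
finite-choice zero    _      = [] , refl , λ _ ()
finite-choice {P} (suc n) choice =
  let ds , len , spec = finite-choice {λ i → P (suc i)} n (λ i i<n → choice (suc i) (s≤s i<n))
      d , Pd = choice 0 (s≤s z≤n)
  in d ∷ ds , cong suc len , λ { zero _ → Pd ; (suc i) (s≤s i<n) → spec i i<n }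

module Grid (k : ℕ) .{{_ : ℕ.NonZero k}} where

  step : ℚ
  step = frac 1 k

  0<step : 0ℚ < step
  0<step = positive⁻¹ step {{normalize-pos 1 k}}

  opaque
    node : ℕ → ℚ
    node i = ι i * step

  opaque
    unfolding node

    node≡frac : ∀ i → node i ≡ frac i k
    node≡frac i = sym (frac≡ι*frac1 i k)

    node-0 : node 0 ≡ 0ℚ
    node-0 = trans (cong (_* step) ι-0) (*-zeroˡ step)

    node-k : node k ≡ 1ℚ
    node-k = ι*frac1≡1 k

    node[1+i]-node[i] : ∀ i → node (suc i) - node i ≡ step
    node[1+i]-node[i] i = trans (cong (λ a → a * step - node i) (trans (ι-+ 1 i) (cong (_+ ι i) ι-1))) (lemma (ι i) step)
      where lemma : ∀ a s → (1ℚ + a) * s - a * s ≡ s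
            lemma = solve 2 (λ a s → ((con 1ℚ) :+ a) :* s :- a :* s := s) refl

    node-mono-≤ : ∀ {i j} → i ℕ.≤ j → node i ≤ node j
    node-mono-≤ i≤j = *-monoʳ-≤-nonNeg step {{nonNegative (<⇒≤ 0<step)}} (ι-mono-≤ i≤j)

    node-mono-< : ∀ {i j} → i ℕ.< j → node i < node j
    node-mono-< i<j = *-monoˡ-<-pos step {{positive 0<step}} (ι-mono-< i<j)

    node-cancel-< : ∀ {i j} → node i < node j → i ℕ.< j
    node-cancel-< nodei<nodej = ι-cancel-< (*-cancelʳ-<-nonNeg step {{nonNegative (<⇒≤ 0<step)}} nodei<nodej)

    node-1 : node 1 ≡ step
    node-1 = trans (cong (_* step) ι-1) (*-identityˡ step)

    node-+ : ∀ m n → ι m * step + node n ≡ node (m ℕ.+ n)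
    node-+ m n = trans (sym (*-distribʳ-+ step (ι m) (ι n))) (cong (_* step) (sym (ι-+ m n)))

    ι[k]*node : ∀ n → ι k * node n ≡ ι n
    ι[k]*node n = trans (lemma (ι k) (ι n) step) (trans (cong (ι n *_) (ι*frac1≡1 k)) (*-identityʳ (ι n)))
      where lemma : ∀ a b s → a * (b * s) ≡ b * (a * s)
            lemma = solve 3 (λ a b s → a :* (b :* s) := b :* (a :* s)) refl

    node-injective : ∀ {i j} → node i ≡ node j → i ≡ j
    node-injective {i} {j} nodei≡nodej with ℕ.<-cmp i j
    ... | tri< i<j _ _ = ⊥-elim (<-irrefl nodei≡nodej (node-mono-< i<j))
    ... | tri≈ _ i≡j _ = i≡j
    ... | tri> _ _ j<i = ⊥-elim (<-irrefl (sym nodei≡nodej) (node-mono-< j<i))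

  0≤node : ∀ i → 0ℚ ≤ node i
  0≤node i = subst (_≤ node i) node-0 (node-mono-≤ {0} {i} z≤n)

  node∈I : ∀ {i} → i ℕ.≤ k → InI (node i)
  node∈I {i} i≤k = 0≤node i , subst (node i ≤_) node-k (node-mono-≤ i≤k)

  private
    locate-below : ∀ n x → 0ℚ ≤ x → x ≤ node (suc n) → ∃ λ i → i ℕ.≤ n × node i ≤ x × x ≤ node (suc i)
    locate-below zero    x 0≤x x≤node₁ = 0 , z≤n , subst (_≤ x) (sym node-0) 0≤x , x≤node₁
    locate-below (suc n) x 0≤x x≤node[2+n] with x ≤? node (suc n)
    ... | yes x≤node[1+n] = let i , i≤n , lo , hi = locate-below n x 0≤x x≤node[1+n] in
                             i , ℕₚ.m≤n⇒m≤1+n i≤n , lo , hi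
    ... | no  x≰node[1+n] = suc n , ℕₚ.≤-refl , <⇒≤ (≰⇒> x≰node[1+n]) , x≤node[2+n]

  locate : ∀ x → InI x → ∃ λ i → i ℕ.< k × node i ≤ x × x ≤ node (suc i)
  locate x (0≤x , x≤1) =
    let i , i≤pred , lo , hi = locate-below (ℕ.pred k) x 0≤x
                                 (subst (λ n → x ≤ node n) (sym (ℕₚ.suc-pred k)) (subst (x ≤_) (sym node-k) x≤1))
    in i , subst (i ℕ.<_) (ℕₚ.suc-pred k) (s≤s i≤pred) , lo , hi

  ramp : ℕ → ℚ → ℚ
  ramp j x = ((x - node j) ⊔ 0ℚ) ⊓ step

  ramp-monotoneLipschitz : ∀ j → MonotoneLipschitz 1ℚ (ramp j)
  ramp-monotoneLipschitz j = ∘-monotoneLipschitz (⊓-monotoneLipschitz step)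
    (∘-monotoneLipschitz (⊔-monotoneLipschitz 0ℚ) (shift-monotoneLipschitz (node j)))

  ramp-below : ∀ {j x} → x ≤ node j → ramp j x ≡ 0ℚ
  ramp-below {j} {x} x≤node =
    trans (cong (_⊓ step) (p≤q⇒p⊔q≡q (subst (x - node j ≤_) (+-inverseʳ (node j)) (+-monoˡ-≤ (- node j) x≤node))))
          (p≤q⇒p⊓q≡p (<⇒≤ 0<step))

  ramp-between : ∀ {j x} → node j ≤ x → x ≤ node (suc j) → ramp j x ≡ x - node j
  ramp-between {j} {x} node≤x x≤node′ =
    trans (cong (_⊓ step) (p≥q⇒p⊔q≡p (p≤q⇒0≤q-p node≤x)))
          (p≤q⇒p⊓q≡p (subst (x - node j ≤_) (node[1+i]-node[i] j) (+-monoˡ-≤ (- node j) x≤node′)))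

  ramp-above : ∀ {j x} → node (suc j) ≤ x → ramp j x ≡ step
  ramp-above {j} {x} node′≤x = trans (cong (_⊓ step) (p≥q⇒p⊔q≡p 0≤x-node)) (p≥q⇒p⊓q≡q step≤x-node)
    where
    step≤x-node : step ≤ x - node j
    step≤x-node = subst (_≤ x - node j) (node[1+i]-node[i] j) (+-monoˡ-≤ (- node j) node′≤x)
    0≤x-node = ≤-trans (<⇒≤ 0<step) step≤x-node

  fall : ℕ → List ℕ → ℚ → ℚ
  fall j []       x = 0ℚ
  fall j (d ∷ ds) x = ι d * ramp j x + fall (suc j) ds x

  fall-monotoneLipschitz : ∀ j ds → MonotoneLipschitz (ι (sum ds)) (fall j ds)
  fall-monotoneLipschitz j []       = subst (λ L → MonotoneLipschitz L (λ _ → 0ℚ)) (sym ι-0) (const-monotoneLipschitz 0ℚ)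
  fall-monotoneLipschitz j (d ∷ ds) = subst (λ L → MonotoneLipschitz L (fall j (d ∷ ds))) L≡
    (+-monotoneLipschitz {L = ι d * 1ℚ} {M = ι (sum ds)}
      (*-monotoneLipschitz (0≤ι d) (ramp-monotoneLipschitz j)) (fall-monotoneLipschitz (suc j) ds))
    where
    L≡ : ι d * 1ℚ + ι (sum ds) ≡ ι (d ℕ.+ sum ds)
    L≡ = trans (cong (_+ ι (sum ds)) (*-identityʳ (ι d))) (sym (ι-+ d (sum ds)))

  private
    nothing-fallen : ∀ y → 0ℚ ≡ node 0 + ι 0 * y
    nothing-fallen y = trans (lemma y) (cong₂ (λ n e → n + e * y) (sym node-0) (sym ι-0))
      where lemma : ∀ y → 0ℚ ≡ 0ℚ + 0ℚ * y
            lemma = solve 1 (λ y → (con 0ℚ) := (con 0ℚ) :+ (con 0ℚ) :* y) refl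

  fall-below : ∀ j ds {x} → x ≤ node j → fall j ds x ≡ 0ℚ
  fall-below j []       x≤node = refl
  fall-below j (d ∷ ds) {x} x≤node = begin
    ι d * ramp j x + fall (suc j) ds x ≡⟨ cong₂ (λ r s → ι d * r + s) (ramp-below x≤node)
                                          (fall-below (suc j) ds (≤-trans x≤node (node-mono-≤ (ℕₚ.n≤1+n j)))) ⟩
    ι d * 0ℚ + 0ℚ                      ≡⟨ lemma (ι d) ⟩
    0ℚ                                 ∎
    where
    open ≡-Reasoning
    lemma : ∀ a → a * 0ℚ + 0ℚ ≡ 0ℚ
    lemma = solve 1 (λ a → a :* (con 0ℚ) :+ (con 0ℚ) := (con 0ℚ)) refl

  -- The piece index is passed as n with i + j ≡ n, so that neither the recursion (j ↦ suc j)
  -- nor the use at j = 0 has to rewrite node (i + j).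
  fall-between : ∀ j ds i {n x} → i ℕ.+ j ≡ n → node n ≤ x → x ≤ node (suc n) →
                 fall j ds x ≡ node (sum (take i ds)) + ι (nth i ds) * (x - node n)
  fall-between j []       zero    {x = x} refl _ _ = nothing-fallen (x - node j)
  fall-between j []       (suc i) {x = x} refl _ _ = nothing-fallen (x - node (suc (i ℕ.+ j)))
  fall-between j (d ∷ ds) zero    {x = x} refl node≤x x≤node′ = begin
    ι d * ramp j x + fall (suc j) ds x ≡⟨ cong₂ (λ r s → ι d * r + s) (ramp-between node≤x x≤node′)
                                                                    (fall-below (suc j) ds x≤node′) ⟩
    ι d * (x - node j) + 0ℚ           ≡⟨ lemma (ι d) (x - node j) ⟩
    0ℚ + ι d * (x - node j)           ≡⟨ cong (_+ ι d * (x - node j)) node-0 ⟨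
    node 0 + ι d * (x - node j)       ∎
    where
    open ≡-Reasoning
    lemma : ∀ a y → a * y + 0ℚ ≡ 0ℚ + a * y
    lemma = solve 2 (λ a y → a :* y :+ (con 0ℚ) := (con 0ℚ) :+ a :* y) refl
  fall-between j (d ∷ ds) (suc i) {n} {x} refl node≤x x≤node′ = begin
    ι d * ramp j x + fall (suc j) ds x
      ≡⟨ cong₂ (λ r s → ι d * r + s) (ramp-above (≤-trans (node-mono-≤ (s≤s (ℕₚ.m≤n+m j i))) node≤x))
                                     (fall-between (suc j) ds i (ℕₚ.+-suc i j) node≤x x≤node′) ⟩
    ι d * step + (node P + ι e * (x - node n))
      ≡⟨ +-assoc (ι d * step) (node P) (ι e * (x - node n)) ⟨
    ι d * step + node P + ι e * (x - node n)
      ≡⟨ cong (_+ ι e * (x - node n)) (node-+ d P) ⟩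
    node (d ℕ.+ P) + ι e * (x - node n) ∎
    where
    open ≡-Reasoning
    P = sum (take i ds)
    e = nth i ds

  opaque
    fromSlopes : List ℕ → ℚ → ℚ
    fromSlopes ds x = 1ℚ - fall 0 ds x

  opaque
    unfolding fromSlopes

    fromSlopes-between : ∀ ds i {x} → node i ≤ x → x ≤ node (suc i) →
      fromSlopes ds x ≡ 1ℚ - (node (sum (take i ds)) + ι (nth i ds) * (x - node i))
    fromSlopes-between ds i node≤x x≤node′ = cong (λ y → 1ℚ - y) (fall-between 0 ds i (ℕₚ.+-identityʳ i) node≤x x≤node′)

    fromSlopes-affine : ∀ ds i {x} → node i ≤ x → x ≤ node (suc i) →
      fromSlopes ds x ≡ - ι (nth i ds) * x + (1ℚ - node (sum (take i ds)) + ι (nth i ds) * node i)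
    fromSlopes-affine ds i {x} node≤x x≤node′ =
      trans (fromSlopes-between ds i node≤x x≤node′) (lemma (node (sum (take i ds))) (ι (nth i ds)) (node i) x)
      where lemma : ∀ P e N x → 1ℚ - (P + e * (x - N)) ≡ - e * x + (1ℚ - P + e * N)
            lemma = solve 4 (λ P e N x → (con 1ℚ) :- (P :+ e :* (x :- N)) := :- e :* x :+ ((con 1ℚ) :- P :+ e :* N)) refl

    fromSlopes-antitone : ∀ ds {t u} → t ≤ u → fromSlopes ds u ≤ fromSlopes ds t
    fromSlopes-antitone ds t≤u = +-monoʳ-≤ 1ℚ (neg-antimono-≤ (proj₁ (fall-monotoneLipschitz 0 ds t≤u)))

    fromSlopes-continuous : ∀ ds → Continuous (fromSlopes ds)
    fromSlopes-continuous ds = lipschitz⇒continuous {fromSlopes ds} (sum ds) λ t u → begin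
      ∣ fromSlopes ds u - fromSlopes ds t ∣ ≡⟨ cong ∣_∣ (lemma (fall 0 ds t) (fall 0 ds u)) ⟩
      ∣ fall 0 ds t - fall 0 ds u ∣         ≤⟨ monotoneLipschitz⇒lipschitz {ι (sum ds)} (fall-monotoneLipschitz 0 ds) u t ⟩
      ι (sum ds) * ∣ t - u ∣                ≡⟨ cong (ι (sum ds) *_) (∣p-q∣≡∣q-p∣ t u) ⟩
      ι (sum ds) * ∣ u - t ∣                ∎
      where
      open ≤-Reasoning
      lemma : ∀ a b → (1ℚ - b) - (1ℚ - a) ≡ a - b
      lemma = solve 2 (λ a b → ((con 1ℚ) :- b) :- ((con 1ℚ) :- a) := a :- b) refl

  fromSlopes-node : ∀ ds i → fromSlopes ds (node i) ≡ 1ℚ - node (sum (take i ds))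
  fromSlopes-node ds i =
    trans (fromSlopes-between ds i ≤-refl (node-mono-≤ (ℕₚ.n≤1+n i))) (lemma (node (sum (take i ds))) (ι (nth i ds)) (node i))
    where lemma : ∀ P e N → 1ℚ - (P + e * (N - N)) ≡ 1ℚ - P
          lemma = solve 3 (λ P e N → (con 1ℚ) :- (P :+ e :* (N :- N)) := (con 1ℚ) :- P) refl


  fromSlopes-0 : ∀ ds → fromSlopes ds 0ℚ ≡ 1ℚ
  fromSlopes-0 ds = begin
    fromSlopes ds 0ℚ       ≡⟨ cong (fromSlopes ds) node-0 ⟨
    fromSlopes ds (node 0) ≡⟨ fromSlopes-node ds 0 ⟩
    1ℚ - node 0            ≡⟨ cong (λ y → 1ℚ - y) node-0 ⟩
    1ℚ - 0ℚ                ≡⟨ +-identityʳ 1ℚ ⟩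
    1ℚ                     ∎
    where open ≡-Reasoning

  module _ (ds : List ℕ) (len : length ds ≡ k) (ballot : PrefixBound 0 ds) where

    private
      F = fromSlopes ds

      ballot-k : ∀ i → i ℕ.< k → sum (take (suc i) ds) ℕ.≤ i
      ballot-k i i<k = ballot i (subst (i ℕ.<_) (sym len) i<k)

      prefix< : ∀ i → 1 ℕ.≤ i → i ℕ.≤ k → sum (take i ds) ℕ.< i
      prefix< (suc i) _ i<k = s≤s (ballot-k i i<k)

      prefix≤ : ∀ i → i ℕ.≤ k → sum (take i ds) ℕ.≤ i
      prefix≤ zero    _   = z≤n
      prefix≤ (suc i) i<k = ℕₚ.<⇒≤ (prefix< (suc i) (s≤s z≤n) i<k)

      nth-0 : nth 0 ds ≡ 0
      nth-0 = ℕₚ.n≤0⇒n≡0 (subst (ℕ._≤ 0) (sum-take-suc 0 ds) (ballot-k 0 (ℕₚ.n≢0⇒n>0 (ℕ.≢-nonZero⁻¹ k))))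

      -- Writing a = node i + t with 0 < t ≤ step and r = i − (D + e) ≥ 0, where D is the
      -- height fallen before the piece and e its slope, F a − (1 − a) = e (step − t) + r step + t.
      above-diagonal-inside : ∀ {a i} → i ℕ.< k → node i < a → a ≤ node (suc i) → 1ℚ - a < F a
      above-diagonal-inside {a} {i} i<k node<a a≤node′ = 0<q-p⇒p<q (subst (0ℚ <_) (sym G≡) 0<G)
        where
        D = sum (take i ds)
        e = nth i ds
        D+e≤i : D ℕ.+ e ℕ.≤ i
        D+e≤i = subst (ℕ._≤ i) (sum-take-suc i ds) (ballot-k i i<k)
        r = i ℕ.∸ (D ℕ.+ e)
        node-i≡ : node i ≡ ι r * step + (ι e * step + node D)
        node-i≡ = begin
          node i                              ≡⟨ cong node (ℕₚ.m∸n+n≡m D+e≤i) ⟨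
          node (r ℕ.+ (D ℕ.+ e))              ≡⟨ cong (λ n → node (r ℕ.+ n)) (ℕₚ.+-comm D e) ⟩
          node (r ℕ.+ (e ℕ.+ D))              ≡⟨ node-+ r (e ℕ.+ D) ⟨
          ι r * step + node (e ℕ.+ D)         ≡⟨ cong (λ y → ι r * step + y) (node-+ e D) ⟨
          ι r * step + (ι e * step + node D)  ∎
          where open ≡-Reasoning
        t = a - node i
        0<t = p<q⇒0<q-p node<a
        t≤step : 0ℚ ≤ step - t
        t≤step = p≤q⇒0≤q-p (subst (t ≤_) (node[1+i]-node[i] i) (+-monoˡ-≤ (- node i) a≤node′))
        G≡ : F a - (1ℚ - a) ≡ ι e * (step - t) + ι r * step + t
        G≡ = begin
          F a - (1ℚ - a)
            ≡⟨ cong (_- (1ℚ - a)) (fromSlopes-between ds i (<⇒≤ node<a) a≤node′) ⟩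
          1ℚ - (node D + ι e * (a - node i)) - (1ℚ - a)
            ≡⟨ decompose (node D) (ι e) (ι r) step a (node i) node-i≡ ⟩
          ι e * (step - t) + ι r * step + t
            ∎
          where
          open ≡-Reasoning
          decompose : ∀ D e r s a N → N ≡ r * s + (e * s + D) →
                      1ℚ - (D + e * (a - N)) - (1ℚ - a) ≡ e * (s - (a - N)) + r * s + (a - N)
          decompose D e r s a _ refl = solve 5 (λ D e r s a →
            con 1ℚ :- (D :+ e :* (a :- (r :* s :+ (e :* s :+ D)))) :- (con 1ℚ :- a) :=
            e :* (s :- (a :- (r :* s :+ (e :* s :+ D)))) :+ r :* s :+ (a :- (r :* s :+ (e :* s :+ D)))) refl D e r s a
        0<G : 0ℚ < ι e * (step - t) + ι r * step + t
        0<G = +-mono-≤-< (+-mono-≤ (0≤* (0≤ι e) t≤step) (0≤* (0≤ι r) (<⇒≤ 0<step))) 0<t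

    above-diagonal : ∀ a → 0ℚ < a → a ≤ 1ℚ → 1ℚ - a < F a
    above-diagonal a 0<a a≤1 with locate a (<⇒≤ 0<a , a≤1)
    ... | i , i<k , node≤a , a≤node′ with ≤⇒<⊎≡ node≤a
    ...   | inj₁ node<a  = above-diagonal-inside i<k node<a a≤node′
    ...   | inj₂ node≡a  = subst (λ x → 1ℚ - x < F x) node≡a (subst (1ℚ - node i <_) (sym (fromSlopes-node ds i))
                              (+-monoʳ-< 1ℚ (neg-antimono-< (node-mono-< (prefix< i 1≤i (ℕₚ.<⇒≤ i<k))))))
      where
      1≤i : 1 ℕ.≤ i
      1≤i = ℕₚ.n≢0⇒n>0 λ { refl → <-irrefl (trans (sym node-0) node≡a) 0<a }

    private
      valuesInI : ValuesInI F
      valuesInI x (0≤x , x≤1) = 0≤Fx , Fx≤1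
        where
        0≤Fx : 0ℚ ≤ F x
        0≤Fx = ≤-trans (p≤q⇒0≤q-p (subst (node (sum (take k ds)) ≤_) node-k (node-mono-≤ (prefix≤ k ℕₚ.≤-refl))))
          (subst (_≤ F x) (fromSlopes-node ds k) (fromSlopes-antitone ds (subst (x ≤_) (sym node-k) x≤1)))
        Fx≤1 : F x ≤ 1ℚ
        Fx≤1 = subst (F x ≤_) (fromSlopes-0 ds) (fromSlopes-antitone ds 0≤x)

      piecewiseLinear : PiecewiseLinear F
      piecewiseLinear = applyUpTo node (suc k) , collinear-within-piece
        where
        collinear-within-piece : ∀ x y z → InI x → InI z → x < y → y < z →
          (∀ b → b ∈ applyUpTo node (suc k) → ¬ (x ≤ b × b ≤ z)) → (F y - F x) * (z - x) ≡ (F z - F x) * (y - x)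
        collinear-within-piece x y z Ix _ x<y y<z avoids =
          collinear (- ι e) c (on-piece ≤-refl x≤z) (on-piece (<⇒≤ x<y) (<⇒≤ y<z)) (on-piece x≤z ≤-refl)
          where
          i = proj₁ (locate x Ix)
          i<k = proj₁ (proj₂ (locate x Ix))
          node≤x = proj₁ (proj₂ (proj₂ (locate x Ix)))
          x≤node′ = proj₂ (proj₂ (proj₂ (locate x Ix)))
          x≤z = <⇒≤ (<-trans x<y y<z)
          z≤node′ : z ≤ node (suc i)
          z≤node′ = ≮⇒≥ λ node′<z → avoids (node (suc i)) (∈-applyUpTo⁺ node (s≤s i<k)) (x≤node′ , <⇒≤ node′<z)
          e = nth i ds
          c = 1ℚ - node (sum (take i ds)) + ι e * node i
          on-piece : ∀ {w} → x ≤ w → w ≤ z → F w ≡ - ι e * w + c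
          on-piece x≤w w≤z = fromSlopes-affine ds i (≤-trans node≤x x≤w) (≤-trans w≤z z≤node′)

      flat-start : ∀ x → 0ℚ ≤ x → x < step → F x ≡ 1ℚ
      flat-start x 0≤x x<step = begin
        F x
          ≡⟨ fromSlopes-between ds 0 (subst (_≤ x) (sym node-0) 0≤x) (subst (x ≤_) (sym node-1) (<⇒≤ x<step)) ⟩
        1ℚ - (node 0 + ι (nth 0 ds) * (x - node 0))
          ≡⟨ cong₂ (λ n e → 1ℚ - (n + e * (x - node 0))) node-0 (trans (cong ι nth-0) ι-0) ⟩
        1ℚ - (0ℚ + 0ℚ * (x - node 0))
          ≡⟨ lemma (x - node 0) ⟩
        1ℚ
          ∎
        where
        open ≡-Reasoning
        lemma : ∀ y → 1ℚ - (0ℚ + 0ℚ * y) ≡ 1ℚ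
        lemma = solve 1 (λ y → (con 1ℚ) :- ((con 0ℚ) :+ (con 0ℚ) :* y) := (con 1ℚ)) refl

      integral-at-nodes : ∀ i → 1 ℕ.≤ i → i ℕ.≤ k → Σ ℤ λ z → ℕtoℚ k * F (frac i k) ≡ ℤtoℚ z
      integral-at-nodes i _ i≤k = + (k ℕ.∸ P) , (begin
        ℕtoℚ k * F (frac i k)       ≡⟨ cong₂ (λ a x → a * F x) (ι≡ℕtoℚ k) (node≡frac i) ⟨
        ι k * F (node i)            ≡⟨ cong (ι k *_) (fromSlopes-node ds i) ⟩
        ι k * (1ℚ - node P)         ≡⟨ lemma (ι k) (node P) ⟩
        ι k - ι k * node P          ≡⟨ cong (λ y → ι k - y) (ι[k]*node P) ⟩
        ι k - ι P                   ≡⟨ ι-∸ (ℕₚ.≤-trans (prefix≤ i i≤k) i≤k) ⟨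
        ι (k ℕ.∸ P)                 ≡⟨ ι≡ℕtoℚ (k ℕ.∸ P) ⟩
        ℤtoℚ (+ (k ℕ.∸ P))          ∎)
        where
        open ≡-Reasoning
        P = sum (take i ds)
        lemma : ∀ a b → a * (1ℚ - b) ≡ a - a * b
        lemma = solve 2 (λ a b → a :* ((con 1ℚ) :- b) := a :- a :* b) refl

      affine-on-pieces : ∀ i → 1 ℕ.≤ i → i ℕ.≤ k → Σ ℤ λ s → s ℤ.≤ + 0 × Σ ℚ λ c →
        ∀ x → frac (i ℕ.∸ 1) k < x → x < frac i k → F x ≡ ℤtoℚ s * x + c
      affine-on-pieces (suc i) _ _ = ℤ.- (+ e) , -ℕ≤0 e , c , λ x lo hi →
        trans (fromSlopes-affine ds i (<⇒≤ (subst (_< x) (sym (node≡frac i)) lo))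
                                      (<⇒≤ (subst (x <_) (sym (node≡frac (suc i))) hi)))
              (cong (λ m → m * x + c) (sym (ℤtoℚ-neg e)))
        where
        e = nth i ds
        c = 1ℚ - node (sum (take i ds)) + ι e * node i

    fromSlopes-inPtilde : InPtilde k F × Continuous F
    fromSlopes-inPtilde =
      ( ( valuesInI
        , (λ _ _ _ _ → fromSlopes-antitone ds)
        , piecewiseLinear
        , (step , 0<step , flat-start)
        , subst (_< F 1ℚ) (+-inverseʳ 1ℚ) (above-diagonal 1ℚ (positive⁻¹ 1ℚ) ≤-refl)
        , (λ a 0<a a<1 → F a , continuous⇒rightLimit {F} (fromSlopes-continuous ds) (<⇒≤ 0<a , <⇒≤ a<1)
                                , above-diagonal a 0<a (<⇒≤ a<1)) )
      , integral-at-nodes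
      , continuous⇒upperSemicontinuous {F} (fromSlopes-continuous ds)
      , affine-on-pieces )
      , fromSlopes-continuous ds

  module _ {f : ℚ → ℚ} (f∈P̃ : InPtilde k f) (cont : Continuous f) where

    private
      f-flat-start = proj₁ (proj₂ (proj₂ (proj₂ (proj₁ f∈P̃))))
      0<f1 = proj₁ (proj₂ (proj₂ (proj₂ (proj₂ (proj₁ f∈P̃)))))
      f-right-limits = proj₂ (proj₂ (proj₂ (proj₂ (proj₂ (proj₁ f∈P̃)))))
      f-pieces = proj₂ (proj₂ (proj₂ f∈P̃))

      AffineOnPiece : ℕ → ℕ → Set
      AffineOnPiece i e = Σ ℚ λ c → ∀ x → node i < x → x < node (suc i) → f x ≡ - ι e * x + c

      slope-on-piece : ∀ i → i ℕ.< k → ∃ (AffineOnPiece i)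
      slope-on-piece i i<k =
        let s , s≤0 , c , f≡ = f-pieces (suc i) (s≤s z≤n) i<k
        in ℤ.∣ s ∣ , c , λ x lo hi →
             trans (f≡ x (subst (_< x) (node≡frac i) lo) (subst (x <_) (node≡frac (suc i)) hi))
                   (cong (λ m → m * x + c) (ℤtoℚ-nonPos s≤0))

    slopes : List ℕ
    slopes = proj₁ (finite-choice k slope-on-piece)

    length-slopes : length slopes ≡ k
    length-slopes = proj₁ (proj₂ (finite-choice k slope-on-piece))

    private
      affine : ∀ i → i ℕ.< k → AffineOnPiece i (nth i slopes)
      affine = proj₂ (proj₂ (finite-choice k slope-on-piece))

      affine-closed : ∀ i (i<k : i ℕ.< k) x → node i ≤ x → x ≤ node (suc i) →
                      f x ≡ - ι (nth i slopes) * x + proj₁ (affine i i<k)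
      affine-closed i i<k = affine-on-closure {f} {m = - ι (nth i slopes)} {c = proj₁ (affine i i<k)}
        cont (node∈I (ℕₚ.<⇒≤ i<k)) (node∈I i<k) (node-mono-< (ℕₚ.n<1+n i)) (proj₂ (affine i i<k))

      agree-on-piece : ∀ i → i ℕ.< k → f (node i) ≡ fromSlopes slopes (node i) →
                       ∀ x → node i ≤ x → x ≤ node (suc i) → f x ≡ fromSlopes slopes x
      agree-on-piece i i<k agree-at-node x node≤x x≤node′ = begin
        f x                    ≡⟨ affine-closed i i<k x node≤x x≤node′ ⟩
        - ι e * x + c          ≡⟨ cong (λ d → - ι e * x + d) c≡c′ ⟩
        - ι e * x + c′         ≡⟨ fromSlopes-affine slopes i node≤x x≤node′ ⟨
        fromSlopes slopes x    ∎
        where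
        open ≡-Reasoning
        e = nth i slopes
        c = proj₁ (affine i i<k)
        c′ = 1ℚ - node (sum (take i slopes)) + ι e * node i
        node≤node′ = node-mono-≤ (ℕₚ.n≤1+n i)
        c≡c′ : c ≡ c′
        c≡c′ = +-cancelˡ (- ι e * node i) {c} {c′}
          (trans (sym (affine-closed i i<k (node i) ≤-refl node≤node′))
                 (trans agree-at-node (fromSlopes-affine slopes i ≤-refl node≤node′)))

      agree-at-nodes : ∀ i → i ℕ.≤ k → f (node i) ≡ fromSlopes slopes (node i)
      agree-at-nodes zero    _   = begin
        f (node 0)                  ≡⟨ cong f node-0 ⟩
        f 0ℚ                        ≡⟨ proj₂ (proj₂ f-flat-start) 0ℚ ≤-refl (proj₁ (proj₂ f-flat-start)) ⟩
        1ℚ                          ≡⟨ fromSlopes-0 slopes ⟨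
        fromSlopes slopes 0ℚ        ≡⟨ cong (fromSlopes slopes) node-0 ⟨
        fromSlopes slopes (node 0)  ∎
        where open ≡-Reasoning
      agree-at-nodes (suc i) i<k =
        agree-on-piece i i<k (agree-at-nodes i (ℕₚ.<⇒≤ i<k)) (node (suc i)) (node-mono-≤ (ℕₚ.n≤1+n i)) ≤-refl

    ≈-fromSlopes : f ≈I fromSlopes slopes
    ≈-fromSlopes x Ix =
      let i , i<k , node≤x , x≤node′ = locate x Ix
      in agree-on-piece i i<k (agree-at-nodes i (ℕₚ.<⇒≤ i<k)) x node≤x x≤node′

    private
      above-diagonal-at-node : ∀ i → 1 ℕ.≤ i → i ℕ.≤ k → 1ℚ - node i < f (node i)
      above-diagonal-at-node i 1≤i i≤k with ℕₚ.m≤n⇒m<n∨m≡n i≤k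
      ... | inj₂ refl = subst (λ x → 1ℚ - x < f x) (sym node-k) (subst (_< f 1ℚ) (sym (+-inverseʳ 1ℚ)) 0<f1)
      ... | inj₁ i<k  =
        let 0<node = subst (_< node i) node-0 (node-mono-< 1≤i)
            node<1 = subst (node i <_) node-k (node-mono-< i<k)
            L , limit , 1-a<L = f-right-limits (node i) 0<node node<1
        in subst (1ℚ - node i <_) (continuous⇒rightLimit≡value {f} cont (<⇒≤ 0<node , <⇒≤ node<1) node<1 limit) 1-a<L

    slopes-ballot : PrefixBound 0 slopes
    slopes-ballot i i<len = ℕₚ.≤-pred (node-cancel-< (1-p<1-q⇒q<p (begin-strict
      1ℚ - node (suc i)                       <⟨ above-diagonal-at-node (suc i) (s≤s z≤n) i<k ⟩
      f (node (suc i))                        ≡⟨ agree-at-nodes (suc i) i<k ⟩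
      fromSlopes slopes (node (suc i))        ≡⟨ fromSlopes-node slopes (suc i) ⟩
      1ℚ - node (sum (take (suc i) slopes))   ∎)))
      where
      open ≤-Reasoning
      i<k = subst (i ℕ.<_) length-slopes i<len

  fromSlopes-injective : ∀ {ds es} → length ds ≡ k → length es ≡ k → fromSlopes ds ≈I fromSlopes es → ds ≡ es
  fromSlopes-injective {ds} {es} len-ds len-es ds≈es =
    take-sums-injective ds es (trans len-ds (sym len-es)) λ i i≤len → node-injective (1-p≡1-q⇒p≡q (begin
      1ℚ - node (sum (take i ds))  ≡⟨ fromSlopes-node ds i ⟨
      fromSlopes ds (node i)       ≡⟨ ds≈es (node i) (node∈I (subst (i ℕ.≤_) len-ds i≤len)) ⟩
      fromSlopes es (node i)       ≡⟨ fromSlopes-node es i ⟩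
      1ℚ - node (sum (take i es))  ∎))
    where open ≡-Reasoning

proposition4p6 : (k : ℕ) → .{{_ : NonZero k}} →
    HasCount (λ f → InPtilde k f × Continuous f) (catalan k)
proposition4p6 k = subst (HasCount (λ f → InPtilde k f × Continuous f)) (ballots-catalan k)
  (fromSlopes ∘ elem , in-P̃ , fromSlopes-elem-injective , covers)
  where
  open Grid k
  open Enumeration (enumerateBallots k 0)
  length≡k : ∀ j → length (elem j) ≡ k
  length≡k j = BallotSeq⇒length k 0 (elem j) (sound j)
  in-P̃ : ∀ j → InPtilde k (fromSlopes (elem j)) × Continuous (fromSlopes (elem j))
  in-P̃ j = fromSlopes-inPtilde (elem j) (length≡k j) (BallotSeq⇒PrefixBound k 0 (elem j) (sound j))
  fromSlopes-elem-injective : ∀ j j′ → fromSlopes (elem j) ≈I fromSlopes (elem j′) → j ≡ j′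
  fromSlopes-elem-injective j j′ same = injective (fromSlopes-injective (length≡k j) (length≡k j′) same)
  covers : ∀ f → InPtilde k f × Continuous f → ∃ λ j → f ≈I fromSlopes (elem j)
  covers f (f∈P̃ , cont) =
    let j , elem-j≡slopes = complete (PrefixBound⇒BallotSeq k 0 (slopes f∈P̃ cont) (length-slopes f∈P̃ cont)
                                                              (slopes-ballot f∈P̃ cont))
    in j , λ x Ix → trans (≈-fromSlopes f∈P̃ cont x Ix) (cong (λ ds → fromSlopes ds x) (sym elem-j≡slopes))
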